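{- Let $q$ be a prime power, $\lambda_2=q^5+q^4+q^3-q-1$, and let $\mathcal L$ be a set of planes of ${\rm PG}(7,q)$ and $x$ an integer with $x\le (q+1)(q^2+q+1)$ such that every plane not in $\mathcal L$ meets exactly $x$ planes of $\mathcal L$ in a line and every plane of $\mathcal L$ meets exactly $\lambda_2+x$ other planes of $\mathcal L$ in a line. Call a line full if all planes through it belong to $\mathcal L$, and for a line $g$ that is not full let $\delta_g$ be defined by: $g$ lies in exactly $x-\delta_g$ planes of $\mathcal L$. Let $\pi\in\mathcal L$ be a plane containing no full line. Then $$\sum_g \delta_g=(q^2+q)x-q^2(q^3+q^2+q+1)\le q(q+1)(2q^2+q+1),$$ where the sum runs over all lines $g$ of $\pi$. In particular $x\ge q^3+q$.
   Context: A plane is a 2-dimensional projective subspace of ${\rm PG}(7,q)$. -}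

module Defs where

open import Level using (0ℓ)
open import Data.Nat as ℕ using (ℕ)
open import Data.Integer as ℤ using (ℤ)
open import Data.Fin using (Fin)
open import Data.Vec using (Vec; []; _∷_; lookup; zipWith; map; replicate; foldr; toList)
open import Data.Product using (Σ; Σ-syntax; ∃; ∃-syntax; _×_; _,_)
open import Relation.Binary.PropositionalEquality using (_≡_; _≢_)
open import Relation.Nullary using (¬_)
import Algebra.Structures as AS

-- A finite field with exactly q elements: the carrier is Fin q, with
-- propositional equality.  (Every finite field of order q is GF(q).)

record FiniteField (q : ℕ) : Set where
  field
    _+_ _*_ : Fin q → Fin q → Fin q
    -_      : Fin q → Fin q
    0# 1#   : Fin q
    isCommutativeRing : AS.IsCommutativeRing {A = Fin q} _≡_ _+_ _*_ -_ 0# 1#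
    0≢1     : 0# ≢ 1#
    inverse : ∀ a → a ≢ 0# → ∃[ b ] (a * b ≡ 1#)

-- Projective geometry PG(n-1, q) = subspaces of F^n.

module Geometry {q : ℕ} (F : FiniteField q) (n : ℕ) where
  open FiniteField F

  V : Set
  V = Vec (Fin q) n

  0V : V
  0V = replicate n 0#

  _⊕_ : V → V → V
  _⊕_ = zipWith _+_

  _·_ : Fin q → V → V
  a · v = map (a *_) v

  lincomb : ∀ {k} → Vec (Fin q) k → Vec V k → V
  lincomb []       []       = 0V
  lincomb (a ∷ as) (v ∷ vs) = (a · v) ⊕ lincomb as vs

  LinIndep : ∀ {k} → Vec V k → Set
  LinIndep {k} vs = ∀ (as : Vec (Fin q) k) → lincomb as vs ≡ 0V → as ≡ replicate k 0#

  -- a subspace of vector dimension k (projective dimension k-1),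
  -- given by a basis
  record Sub (k : ℕ) : Set where
    constructor sub
    field
      basis : Vec V k
      indep : LinIndep basis
  open Sub public

  _∈span_ : ∀ {k} → V → Sub k → Set
  _∈span_ {k} v S = ∃[ as ] (lincomb {k} as (basis S) ≡ v)

  _⊆_ : ∀ {j k} → Sub j → Sub k → Set
  _⊆_ {j} S T = ∀ (i : Fin j) → lookup (basis S) i ∈span T

  _≈_ : ∀ {k} → Sub k → Sub k → Set
  S ≈ T = (S ⊆ T) × (T ⊆ S)

  Point Line Plane : Set
  Point = Sub 1
  Line  = Sub 2
  Plane = Sub 3

  -- two planes meet in a line: they are distinct and share a line
  -- (for distinct planes this means the intersection is exactly a line)
  MeetInLine : Plane → Plane → Set
  MeetInLine τ σ = (Σ[ g ∈ Line ] ((g ⊆ τ) × (g ⊆ σ))) × ¬ (τ ≈ σ)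

  -- the set of subspaces (up to ≈) satisfying P has exactly c elements:
  -- there is a list of c pairwise distinct subspaces satisfying P such
  -- that every subspace satisfying P equals one of them
  Count : ∀ {k} → (Sub k → Set) → ℕ → Set
  Count {k} P c =
    Σ[ ss ∈ Vec (Sub k) c ]
      ((∀ i → P (lookup ss i))
     × (∀ i j → lookup ss i ≈ lookup ss j → i ≡ j)
     × (∀ S → P S → ∃[ i ] (S ≈ lookup ss i)))

  EnumLinesOf : Plane → ∀ {m} → Vec Line m → Set
  EnumLinesOf π gs =
      (∀ i → lookup gs i ⊆ π)
    × (∀ i j → lookup gs i ≈ lookup gs j → i ≡ j)
    × (∀ (g : Line) → g ⊆ π → ∃[ i ] (g ≈ lookup gs i))

sumℤ : ∀ {m} → Vec ℤ m → ℤ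
sumℤ {m} = foldr (λ _ → ℤ) ℤ._+_ (ℤ.+ 0)

λ₂ : ℕ → ℤ
λ₂ q = ℤ.+ (q ℕ.^ 5 ℕ.+ q ℕ.^ 4 ℕ.+ q ℕ.^ 3) ℤ.- ℤ.+ q ℤ.- ℤ.+ 1

module Submission where

-- Double count the pairs (g, τ) with g a line of π and τ ∈ L a plane through g.  The planes
-- of L through g are π and the planes of L meeting π in a line that contain g, and each of the
-- λ₂ + x planes of L meeting π in a line contains exactly one line of π, since two planes
-- sharing two lines coincide.  Summing over the q² + q + 1 lines of π (counted through the
-- reduced echelon forms of 2-dimensional subspaces of F_q³) gives
-- Σ_g (x - δ_g) = q² + q + 1 + λ₂ + x, which is the stated value of Σ_g δ_g; the upper bound
-- follows from x ≤ (q + 1)(q² + q + 1).  If g is not full, some plane τ ⊇ g is not in L and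
-- every plane of L through g meets τ in a line, so δ_g ≥ 0.  Thus
-- (q² + q) x ≥ q²(q³ + q² + q + 1) = (q² + q)(q³ + q).

open import Level using (0ℓ)
open import Algebra.Bundles using (CommutativeRing)
import Algebra.Properties.Ring as RingProperties
open import Data.Empty using (⊥; ⊥-elim)
open import Data.Fin as Fin using (Fin; zero; suc; punchIn)
import Data.Fin.Properties as FinP
import Data.Integer as Int
import Data.Integer.Properties as IntP
open import Data.Nat as ℕ using (ℕ)
import Data.Nat.Properties as NatP
import Data.Product
open import Data.Product using (Σ-syntax; ∃; _×_; _,_; proj₁; proj₂; map₂)
open import Data.Sum using (_⊎_; inj₁; inj₂)
open import Data.Sum.Function.Propositional using (_⊎-↔_)
open import Data.Vec using (Vec; []; _∷_; head; lookup; map; zipWith; tabulate; insertAt; removeAt)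
import Data.Vec.Properties as VecP
open import Function using (_∘_)
open import Function.Bundles using (Inverse; _↔_)
open import Function.Properties.Inverse using (↔-trans)
open import Relation.Binary.PropositionalEquality
open import Relation.Nullary using (¬_; Dec; yes; no; ¬?)
open import Relation.Nullary.Decidable using (decidable-stable)

open import Defs

module VectorSpace {q : ℕ} (F : FiniteField q) where
  open FiniteField F using (isCommutativeRing; 0≢1; inverse)

  ring : CommutativeRing 0ℓ 0ℓ
  ring = record { isCommutativeRing = isCommutativeRing }

  open CommutativeRing ring
    using (_+_; _*_; -_; 0#; 1#; +-assoc; +-comm; +-identityˡ; +-identityʳ; -‿inverseʳ;
           *-assoc; *-comm; *-identityˡ; distribˡ; distribʳ; zeroˡ; zeroʳ)
  open RingProperties (CommutativeRing.ring ring) using (-‿distribˡ-*; -1*x≈-x; -‿involutive)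

  Scalar : Set
  Scalar = Fin q

  Vector : ℕ → Set
  Vector n = Vec Scalar n

  infixl 6 _⊕_ _⊖_
  infixr 7 _·_

  _⊕_ : ∀ {n} → Vector n → Vector n → Vector n
  _⊕_ {n} = Geometry._⊕_ F n

  _·_ : ∀ {n} → Scalar → Vector n → Vector n
  _·_ {n} = Geometry._·_ F n

  0ᵥ : ∀ {n} → Vector n
  0ᵥ {n} = Geometry.0V F n

  lincomb : ∀ {n k} → Vector k → Vec (Vector n) k → Vector n
  lincomb {n} = Geometry.lincomb F n

  Independent : ∀ {n k} → Vec (Vector n) k → Set
  Independent {n} = Geometry.LinIndep F n

  ⊕-assoc : ∀ {n} (u v w : Vector n) → (u ⊕ v) ⊕ w ≡ u ⊕ (v ⊕ w)
  ⊕-assoc = VecP.zipWith-assoc +-assoc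

  ⊕-comm : ∀ {n} (u v : Vector n) → u ⊕ v ≡ v ⊕ u
  ⊕-comm = VecP.zipWith-comm +-comm

  ⊕-identityˡ : ∀ {n} (u : Vector n) → 0ᵥ ⊕ u ≡ u
  ⊕-identityˡ = VecP.zipWith-identityˡ +-identityˡ

  ⊕-identityʳ : ∀ {n} (u : Vector n) → u ⊕ 0ᵥ ≡ u
  ⊕-identityʳ = VecP.zipWith-identityʳ +-identityʳ

  ⊕-interchange : ∀ {n} (a b c d : Vector n) → (a ⊕ b) ⊕ (c ⊕ d) ≡ (a ⊕ c) ⊕ (b ⊕ d)
  ⊕-interchange a b c d = begin
    (a ⊕ b) ⊕ (c ⊕ d)  ≡⟨ ⊕-assoc a b (c ⊕ d) ⟩
    a ⊕ (b ⊕ (c ⊕ d))  ≡⟨ cong (a ⊕_) (sym (⊕-assoc b c d)) ⟩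
    a ⊕ ((b ⊕ c) ⊕ d)  ≡⟨ cong (λ z → a ⊕ (z ⊕ d)) (⊕-comm b c) ⟩
    a ⊕ ((c ⊕ b) ⊕ d)  ≡⟨ cong (a ⊕_) (⊕-assoc c b d) ⟩
    a ⊕ (c ⊕ (b ⊕ d))  ≡⟨ sym (⊕-assoc a c (b ⊕ d)) ⟩
    (a ⊕ c) ⊕ (b ⊕ d)  ∎
    where open ≡-Reasoning

  ·-distribˡ-⊕ : ∀ {n} a (u v : Vector n) → a · (u ⊕ v) ≡ a · u ⊕ a · v
  ·-distribˡ-⊕ a [] [] = refl
  ·-distribˡ-⊕ a (b ∷ u) (c ∷ v) = cong₂ _∷_ (distribˡ a b c) (·-distribˡ-⊕ a u v)

  ·-distribʳ-+ : ∀ {n} a b (u : Vector n) → (a + b) · u ≡ a · u ⊕ b · u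
  ·-distribʳ-+ a b [] = refl
  ·-distribʳ-+ a b (c ∷ u) = cong₂ _∷_ (distribʳ c a b) (·-distribʳ-+ a b u)

  ·-assoc : ∀ {n} a b (u : Vector n) → a · b · u ≡ (a * b) · u
  ·-assoc a b [] = refl
  ·-assoc a b (c ∷ u) = cong₂ _∷_ (sym (*-assoc a b c)) (·-assoc a b u)

  ·-zeroˡ : ∀ {n} (u : Vector n) → 0# · u ≡ 0ᵥ
  ·-zeroˡ [] = refl
  ·-zeroˡ (c ∷ u) = cong₂ _∷_ (zeroˡ c) (·-zeroˡ u)

  ·-zeroʳ : ∀ {n} a → a · 0ᵥ {n} ≡ 0ᵥ
  ·-zeroʳ {ℕ.zero} a = refl
  ·-zeroʳ {ℕ.suc n} a = cong₂ _∷_ (zeroʳ a) (·-zeroʳ a)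

  ·-identityˡ : ∀ {n} (u : Vector n) → 1# · u ≡ u
  ·-identityˡ [] = refl
  ·-identityˡ (c ∷ u) = cong₂ _∷_ (*-identityˡ c) (·-identityˡ u)

  _⊖_ : ∀ {n} → Vector n → Vector n → Vector n
  u ⊖ v = u ⊕ (- 1#) · v

  ⊖-self : ∀ {n} (u : Vector n) → u ⊖ u ≡ 0ᵥ
  ⊖-self u = begin
    u ⊕ (- 1#) · u        ≡⟨ cong (_⊕ (- 1#) · u) (sym (·-identityˡ u)) ⟩
    1# · u ⊕ (- 1#) · u   ≡⟨ sym (·-distribʳ-+ 1# (- 1#) u) ⟩
    (1# + - 1#) · u       ≡⟨ cong (_· u) (-‿inverseʳ 1#) ⟩
    0# · u                ≡⟨ ·-zeroˡ u ⟩
    0ᵥ                    ∎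
    where open ≡-Reasoning

  ⊕≡0⇒≡-neg : ∀ {n} (u v : Vector n) → u ⊕ v ≡ 0ᵥ → u ≡ (- 1#) · v
  ⊕≡0⇒≡-neg u v u⊕v≡0 = begin
    u                       ≡⟨ sym (⊕-identityʳ u) ⟩
    u ⊕ 0ᵥ                  ≡⟨ cong (u ⊕_) (sym (⊖-self v)) ⟩
    u ⊕ (v ⊕ (- 1#) · v)    ≡⟨ sym (⊕-assoc u v _) ⟩
    (u ⊕ v) ⊕ (- 1#) · v    ≡⟨ cong (_⊕ (- 1#) · v) u⊕v≡0 ⟩
    0ᵥ ⊕ (- 1#) · v         ≡⟨ ⊕-identityˡ _ ⟩
    (- 1#) · v              ∎
    where open ≡-Reasoning

  ⊖≡0⇒≡ : ∀ {n} (u v : Vector n) → u ⊖ v ≡ 0ᵥ → u ≡ v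
  ⊖≡0⇒≡ u v u⊖v≡0 = begin
    u                      ≡⟨ ⊕≡0⇒≡-neg u _ u⊖v≡0 ⟩
    (- 1#) · (- 1#) · v    ≡⟨ ·-assoc _ _ v ⟩
    (- 1# * - 1#) · v      ≡⟨ cong (_· v) -1*-1≡1 ⟩
    1# · v                 ≡⟨ ·-identityˡ v ⟩
    v                      ∎
    where
    open ≡-Reasoning
    -1*-1≡1 : - 1# * - 1# ≡ 1#
    -1*-1≡1 = trans (-1*x≈-x (- 1#)) (-‿involutive 1#)

  lincomb-⊕ : ∀ {n k} (as bs : Vector k) (vs : Vec (Vector n) k) →
              lincomb (as ⊕ bs) vs ≡ lincomb as vs ⊕ lincomb bs vs
  lincomb-⊕ [] [] [] = sym (⊕-identityˡ 0ᵥ)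
  lincomb-⊕ (a ∷ as) (b ∷ bs) (v ∷ vs) = begin
    (a + b) · v ⊕ lincomb (as ⊕ bs) vs
      ≡⟨ cong₂ _⊕_ (·-distribʳ-+ a b v) (lincomb-⊕ as bs vs) ⟩
    (a · v ⊕ b · v) ⊕ (lincomb as vs ⊕ lincomb bs vs)
      ≡⟨ ⊕-interchange _ _ _ _ ⟩
    (a · v ⊕ lincomb as vs) ⊕ (b · v ⊕ lincomb bs vs) ∎
    where open ≡-Reasoning

  lincomb-· : ∀ {n k} c (as : Vector k) (vs : Vec (Vector n) k) →
              lincomb (c · as) vs ≡ c · lincomb as vs
  lincomb-· c [] [] = sym (·-zeroʳ c)
  lincomb-· c (a ∷ as) (v ∷ vs) = begin
    (c * a) · v ⊕ lincomb (c · as) vs  ≡⟨ cong₂ _⊕_ (sym (·-assoc c a v)) (lincomb-· c as vs) ⟩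
    c · a · v ⊕ c · lincomb as vs      ≡⟨ sym (·-distribˡ-⊕ c _ _) ⟩
    c · (a · v ⊕ lincomb as vs)        ∎
    where open ≡-Reasoning

  lincomb-zero : ∀ {n k} (vs : Vec (Vector n) k) → lincomb 0ᵥ vs ≡ 0ᵥ
  lincomb-zero [] = refl
  lincomb-zero (v ∷ vs) = trans (cong₂ _⊕_ (·-zeroˡ v) (lincomb-zero vs)) (⊕-identityˡ 0ᵥ)

  lincomb-lincomb : ∀ {n j k} (as : Vector k) (B : Vec (Vector j) k) (vs : Vec (Vector n) j) →
                    lincomb as (map (λ b → lincomb b vs) B) ≡ lincomb (lincomb as B) vs
  lincomb-lincomb [] [] vs = sym (lincomb-zero vs)
  lincomb-lincomb (a ∷ as) (b ∷ B) vs = begin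
    a · lincomb b vs ⊕ lincomb as (map (λ b → lincomb b vs) B)
      ≡⟨ cong₂ _⊕_ (sym (lincomb-· a b vs)) (lincomb-lincomb as B vs) ⟩
    lincomb (a · b) vs ⊕ lincomb (lincomb as B) vs
      ≡⟨ sym (lincomb-⊕ (a · b) (lincomb as B) vs) ⟩
    lincomb (a · b ⊕ lincomb as B) vs ∎
    where open ≡-Reasoning

  lincomb-insertAt : ∀ {n k} (cs : Vector k) (ws : Vec (Vector n) k) i c w →
                     lincomb (insertAt cs i c) (insertAt ws i w) ≡ c · w ⊕ lincomb cs ws
  lincomb-insertAt cs ws zero c w = refl
  lincomb-insertAt (c′ ∷ cs) (w′ ∷ ws) (suc i) c w = begin
    c′ · w′ ⊕ lincomb (insertAt cs i c) (insertAt ws i w)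
      ≡⟨ cong (c′ · w′ ⊕_) (lincomb-insertAt cs ws i c w) ⟩
    c′ · w′ ⊕ (c · w ⊕ lincomb cs ws)  ≡⟨ sym (⊕-assoc _ _ _) ⟩
    (c′ · w′ ⊕ c · w) ⊕ lincomb cs ws  ≡⟨ cong (_⊕ lincomb cs ws) (⊕-comm _ _) ⟩
    (c · w ⊕ c′ · w′) ⊕ lincomb cs ws  ≡⟨ ⊕-assoc _ _ _ ⟩
    c · w ⊕ (c′ · w′ ⊕ lincomb cs ws)  ∎
    where open ≡-Reasoning

  infix 4 _∈⟨_⟩

  _∈⟨_⟩ : ∀ {n k} → Vector n → Vec (Vector n) k → Set
  v ∈⟨ vs ⟩ = ∃ λ as → lincomb as vs ≡ v

  _⊆⟨_⟩ : ∀ {n j k} → Vec (Vector n) k → Vec (Vector n) j → Set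
  ws ⊆⟨ vs ⟩ = ∀ i → lookup ws i ∈⟨ vs ⟩

  ∈⟨⟩-⊕ : ∀ {n k} {u v : Vector n} {vs : Vec (Vector n) k} →
          u ∈⟨ vs ⟩ → v ∈⟨ vs ⟩ → u ⊕ v ∈⟨ vs ⟩
  ∈⟨⟩-⊕ {vs = vs} (a , refl) (b , refl) = a ⊕ b , lincomb-⊕ a b vs

  ∈⟨⟩-· : ∀ {n k} c {u : Vector n} {vs : Vec (Vector n) k} → u ∈⟨ vs ⟩ → c · u ∈⟨ vs ⟩
  ∈⟨⟩-· c {vs = vs} (a , refl) = c · a , lincomb-· c a vs

  lincomb-∈⟨⟩ : ∀ {n j k} {ws : Vec (Vector n) k} {vs : Vec (Vector n) j} →
                ws ⊆⟨ vs ⟩ → ∀ as → lincomb as ws ∈⟨ vs ⟩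
  lincomb-∈⟨⟩ {ws = []} {vs} ws⊆vs [] = 0ᵥ , lincomb-zero vs
  lincomb-∈⟨⟩ {ws = w ∷ ws} {vs} ws⊆vs (a ∷ as) =
    ∈⟨⟩-⊕ (∈⟨⟩-· a (ws⊆vs zero)) (lincomb-∈⟨⟩ (λ i → ws⊆vs (suc i)) as)

  ∈⟨⟩-trans : ∀ {n j k} {v : Vector n} {ws : Vec (Vector n) k} {vs : Vec (Vector n) j} →
              v ∈⟨ ws ⟩ → ws ⊆⟨ vs ⟩ → v ∈⟨ vs ⟩
  ∈⟨⟩-trans (as , refl) ws⊆vs = lincomb-∈⟨⟩ ws⊆vs as

  unit : ∀ {k} → Fin k → Vector k
  unit zero = 1# ∷ 0ᵥ
  unit (suc i) = 0# ∷ unit i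

  lincomb-unit : ∀ {n k} (i : Fin k) (vs : Vec (Vector n) k) → lincomb (unit i) vs ≡ lookup vs i
  lincomb-unit zero (v ∷ vs) = trans (cong₂ _⊕_ (·-identityˡ v) (lincomb-zero vs)) (⊕-identityʳ v)
  lincomb-unit (suc i) (v ∷ vs) = trans (cong₂ _⊕_ (·-zeroˡ v) (lincomb-unit i vs)) (⊕-identityˡ _)

  ⊆⟨⟩-refl : ∀ {n k} (vs : Vec (Vector n) k) → vs ⊆⟨ vs ⟩
  ⊆⟨⟩-refl vs i = unit i , lincomb-unit i vs

  ·≡0⇒≡0 : ∀ {k} p (c : Vector k) → p ≢ 0# → p · c ≡ 0ᵥ → c ≡ 0ᵥ
  ·≡0⇒≡0 p c p≢0 p·c≡0 with inverse p p≢0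
  ... | s , p*s≡1 = begin
    c              ≡⟨ sym (·-identityˡ c) ⟩
    1# · c         ≡⟨ cong (_· c) (sym (trans (*-comm s p) p*s≡1)) ⟩
    (s * p) · c    ≡⟨ sym (·-assoc s p c) ⟩
    s · p · c      ≡⟨ cong (s ·_) p·c≡0 ⟩
    s · 0ᵥ         ≡⟨ ·-zeroʳ s ⟩
    0ᵥ             ∎
    where open ≡-Reasoning

  Dependent : ∀ {n k} → Vec (Vector n) k → Set
  Dependent ws = ∃ λ cs → cs ≢ 0ᵥ × lincomb cs ws ≡ 0ᵥ

  dependent-insertAt : ∀ {n k} (Ws : Vec (Vector n) k) i w {p a} {c : Vector k} →
                       p ≢ 0# → c ≢ 0ᵥ → lincomb (p · c) Ws ⊕ a · w ≡ 0ᵥ → Dependent (insertAt Ws i w)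
  dependent-insertAt Ws i w {p} {a} {c} p≢0 c≢0 eq = insertAt (p · c) i a , cs≢0 , lincomb-cs
    where
    cs≢0 : insertAt (p · c) i a ≢ 0ᵥ
    cs≢0 cs≡0 = c≢0 (·≡0⇒≡0 p c p≢0 (begin
      p · c                              ≡⟨ sym (VecP.removeAt-insertAt (p · c) i a) ⟩
      removeAt (insertAt (p · c) i a) i  ≡⟨ cong (λ cs → removeAt cs i) cs≡0 ⟩
      removeAt 0ᵥ i                      ≡⟨ removeAt-zero i ⟩
      0ᵥ                                 ∎))
      where
      open ≡-Reasoning
      removeAt-zero : ∀ {k} (i : Fin (ℕ.suc k)) → removeAt (0ᵥ {ℕ.suc k}) i ≡ 0ᵥ
      removeAt-zero zero = refl
      removeAt-zero {ℕ.suc k} (suc i) = cong (0# ∷_) (removeAt-zero i)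
    lincomb-cs : lincomb (insertAt (p · c) i a) (insertAt Ws i w) ≡ 0ᵥ
    lincomb-cs = trans (lincomb-insertAt (p · c) Ws i a w) (trans (⊕-comm _ _) eq)

  dot : ∀ {k} → Vector k → Vector k → Scalar
  dot [] [] = 0#
  dot (c ∷ cs) (a ∷ as) = c * a + dot cs as

  lincomb-eliminated : ∀ {n k} p (w : Vector n) (c : Vector k) (Ws : Vec (Vector n) k) (αs : Vector k) →
    lincomb c (zipWith (λ W α → p · W ⊕ α · w) Ws αs) ≡ lincomb (p · c) Ws ⊕ dot c αs · w
  lincomb-eliminated p w [] [] [] = sym (trans (cong (0ᵥ ⊕_) (·-zeroˡ w)) (⊕-identityˡ 0ᵥ))
  lincomb-eliminated p w (c ∷ cs) (W ∷ Ws) (α ∷ αs) = begin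
    c · (p · W ⊕ α · w) ⊕ lincomb cs (zipWith (λ W α → p · W ⊕ α · w) Ws αs)
      ≡⟨ cong₂ _⊕_ (·-distribˡ-⊕ c _ _) (lincomb-eliminated p w cs Ws αs) ⟩
    (c · p · W ⊕ c · α · w) ⊕ (lincomb (p · cs) Ws ⊕ dot cs αs · w)
      ≡⟨ ⊕-interchange _ _ _ _ ⟩
    (c · p · W ⊕ lincomb (p · cs) Ws) ⊕ (c · α · w ⊕ dot cs αs · w)
      ≡⟨ cong₂ (λ u v → u ⊕ lincomb (p · cs) Ws ⊕ v) (trans (·-assoc c p W) (cong (_· W) (*-comm c p)))
               (trans (cong (_⊕ dot cs αs · w) (·-assoc c α w)) (sym (·-distribʳ-+ _ _ w))) ⟩
    ((p * c) · W ⊕ lincomb (p · cs) Ws) ⊕ (c * α + dot cs αs) · w ∎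
    where open ≡-Reasoning

  eliminate-head : ∀ {n k} (v : Vector n) (vs : Vec (Vector n) k) (X Y : Vector (ℕ.suc k)) →
    head Y · lincomb X (v ∷ vs) ⊕ (- head X) · lincomb Y (v ∷ vs) ∈⟨ vs ⟩
  eliminate-head v vs (a ∷ A) (p ∷ B) = p · A ⊕ (- a) · B , (begin
    lincomb (p · A ⊕ (- a) · B) vs
      ≡⟨ sym (trans (cong (_⊕ _) (·-zeroˡ v)) (⊕-identityˡ _)) ⟩
    0# · v ⊕ lincomb (p · A ⊕ (- a) · B) vs
      ≡⟨ cong (λ z → z · v ⊕ lincomb (p · A ⊕ (- a) · B) vs) (sym p*a-a*p≡0) ⟩
    (p * a + - a * p) · v ⊕ lincomb (p · A ⊕ (- a) · B) vs
      ≡⟨ lincomb-⊕ (p · (a ∷ A)) ((- a) · (p ∷ B)) (v ∷ vs) ⟩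
    lincomb (p · (a ∷ A)) (v ∷ vs) ⊕ lincomb ((- a) · (p ∷ B)) (v ∷ vs)
      ≡⟨ cong₂ _⊕_ (lincomb-· p (a ∷ A) (v ∷ vs)) (lincomb-· (- a) (p ∷ B) (v ∷ vs)) ⟩
    p · lincomb (a ∷ A) (v ∷ vs) ⊕ (- a) · lincomb (p ∷ B) (v ∷ vs) ∎)
    where
    open ≡-Reasoning
    p*a-a*p≡0 : p * a + - a * p ≡ 0#
    p*a-a*p≡0 = trans (cong (p * a +_) (trans (sym (-‿distribˡ-* a p)) (cong -_ (*-comm a p)))) (-‿inverseʳ (p * a))

  dependent-∷ : ∀ {n k} (w : Vector n) {ws : Vec (Vector n) k} → Dependent ws → Dependent (w ∷ ws)
  dependent-∷ w (c , c≢0 , eq) =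
    0# ∷ c , (λ e → c≢0 (VecP.∷-injectiveʳ e)) , trans (cong₂ _⊕_ (·-zeroˡ w) eq) (⊕-identityˡ 0ᵥ)

  ∈⟨∷⟩-head-zero : ∀ {n k} {w v : Vector n} {vs : Vec (Vector n) k} (X : Vector (ℕ.suc k)) →
                   lincomb X (v ∷ vs) ≡ w → head X ≡ 0# → w ∈⟨ vs ⟩
  ∈⟨∷⟩-head-zero {v = v} {vs} (a ∷ A) eq refl =
    A , trans (sym (trans (cong (_⊕ lincomb A vs) (·-zeroˡ v)) (⊕-identityˡ _))) eq

  -- Eliminate the first spanner v: if some wᵢ has a nonzero v-coefficient p, then the vectors
  -- p wⱼ - aⱼ wᵢ (j ≠ i, aⱼ the v-coefficient of wⱼ) lie in the span of the other spanners,
  -- and a dependency among them lifts to one among ws.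
  more-vectors-than-span⇒dependent : ∀ {n} k (ws : Vec (Vector n) (ℕ.suc k)) (vs : Vec (Vector n) k) →
                                     ws ⊆⟨ vs ⟩ → Dependent ws
  more-vectors-than-span⇒dependent ℕ.zero (w ∷ []) [] ws⊆ with ws⊆ zero
  ... | [] , refl = 1# ∷ [] , (λ e → 0≢1 (sym (VecP.∷-injectiveˡ e))) ,
                    trans (cong (_⊕ 0ᵥ) (·-zeroʳ 1#)) (⊕-identityˡ 0ᵥ)
  more-vectors-than-span⇒dependent (ℕ.suc k) ws@(w₀ ∷ ws′) (v ∷ vs) ws⊆ =
    by-pivot (FinP.any? (λ i → ¬? (head (X i) Fin.≟ 0#)))
    where
    X : Fin (ℕ.suc (ℕ.suc k)) → Vector (ℕ.suc k)
    X i = proj₁ (ws⊆ i)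
    by-pivot : Dec (∃ λ i → head (X i) ≢ 0#) → Dependent ws
    by-pivot (no no-pivot) = dependent-∷ w₀ (more-vectors-than-span⇒dependent k ws′ vs λ i →
      ∈⟨∷⟩-head-zero (X (suc i)) (proj₂ (ws⊆ (suc i)))
        (decidable-stable (_ Fin.≟ 0#) (no-pivot ∘ (suc i ,_))))
    by-pivot (yes (i₀ , p≢0)) =
      subst Dependent (VecP.insertAt-removeAt ws i₀)
        (dependent-insertAt Ws i₀ w p≢0 c≢0 (trans (sym (lincomb-eliminated p w c Ws αs)) eq))
      where
      p = head (X i₀)
      w = lookup ws i₀
      Ws = removeAt ws i₀
      a : Fin (ℕ.suc k) → Scalar
      a j = head (X (punchIn i₀ j))
      αs = tabulate (-_ ∘ a)
      reduced = zipWith (λ W α → p · W ⊕ α · w) Ws αs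
      lookup-Ws : ∀ j → lookup Ws j ≡ lookup ws (punchIn i₀ j)
      lookup-Ws j = trans (sym (VecP.insertAt-punchIn Ws i₀ w j))
                          (cong (λ us → lookup us (punchIn i₀ j)) (VecP.insertAt-removeAt ws i₀))
      lookup-reduced : ∀ j → lookup reduced j ≡
        p · lincomb (X (punchIn i₀ j)) (v ∷ vs) ⊕ (- a j) · lincomb (X i₀) (v ∷ vs)
      lookup-reduced j = begin
        lookup reduced j                               ≡⟨ VecP.lookup-zipWith _ j Ws αs ⟩
        p · lookup Ws j ⊕ lookup αs j · w              ≡⟨ cong₂ (λ W α → p · W ⊕ α · w) (lookup-Ws j)
                                                                (VecP.lookup∘tabulate (-_ ∘ a) j) ⟩
        p · lookup ws (punchIn i₀ j) ⊕ (- a j) · w     ≡⟨ cong₂ (λ u u′ → p · u ⊕ (- a j) · u′)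
                                                                (sym (proj₂ (ws⊆ (punchIn i₀ j))))
                                                                (sym (proj₂ (ws⊆ i₀))) ⟩
        p · lincomb (X (punchIn i₀ j)) (v ∷ vs) ⊕ (- a j) · lincomb (X i₀) (v ∷ vs) ∎
        where open ≡-Reasoning
      reduced⊆ : reduced ⊆⟨ vs ⟩
      reduced⊆ j = subst (_∈⟨ vs ⟩) (sym (lookup-reduced j)) (eliminate-head v vs (X (punchIn i₀ j)) (X i₀))
      dependency = more-vectors-than-span⇒dependent k _ vs reduced⊆
      c = proj₁ dependency
      c≢0 = proj₁ (proj₂ dependency)
      eq = proj₂ (proj₂ dependency)

  ∃-vector? : ∀ k {P : Vector k → Set} → (∀ as → Dec (P as)) → Dec (∃ P)
  ∃-vector? ℕ.zero P? with P? []
  ... | yes p = yes ([] , p)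
  ... | no ¬p = no λ { ([] , p) → ¬p p }
  ∃-vector? (ℕ.suc k) P? with FinP.any? (λ a → ∃-vector? k (λ as → P? (a ∷ as)))
  ... | yes (a , as , p) = yes (a ∷ as , p)
  ... | no ¬p = no λ { (a ∷ as , p) → ¬p (a , as , p) }

  _∈⟨_⟩? : ∀ {n k} (v : Vector n) (vs : Vec (Vector n) k) → Dec (v ∈⟨ vs ⟩)
  _∈⟨_⟩? {k = k} v vs = ∃-vector? k (λ as → VecP.≡-dec Fin._≟_ (lincomb as vs) v)

  ∈⟨⟩-by-dependency : ∀ {n k} {c} {v : Vector n} {c′ : Vector k} {ws : Vec (Vector n) k} →
                      c ≢ 0# → c · v ⊕ lincomb c′ ws ≡ 0ᵥ → v ∈⟨ ws ⟩
  ∈⟨⟩-by-dependency {c = c} {v} {c′} {ws} c≢0 eq with inverse c c≢0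
  ... | s , c*s≡1 = (s * - 1#) · c′ , (begin
    lincomb ((s * - 1#) · c′) ws  ≡⟨ lincomb-· _ c′ ws ⟩
    (s * - 1#) · lincomb c′ ws    ≡⟨ sym (·-assoc s _ _) ⟩
    s · (- 1#) · lincomb c′ ws    ≡⟨ cong (s ·_) (sym (⊕≡0⇒≡-neg (c · v) (lincomb c′ ws) eq)) ⟩
    s · c · v                     ≡⟨ ·-assoc s c v ⟩
    (s * c) · v                   ≡⟨ cong (_· v) (trans (*-comm s c) c*s≡1) ⟩
    1# · v                        ≡⟨ ·-identityˡ v ⟩
    v                             ∎)
    where open ≡-Reasoning

  independent-∷ : ∀ {n k} {v : Vector n} {ws : Vec (Vector n) k} →
                  ¬ v ∈⟨ ws ⟩ → Independent ws → Independent (v ∷ ws)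
  independent-∷ {v = v} {ws} v∉ws ws-indep (c ∷ c′) eq with c Fin.≟ 0#
  ... | yes refl = cong (0# ∷_) (ws-indep c′ (trans (sym (trans (cong (_⊕ _) (·-zeroˡ v)) (⊕-identityˡ _))) eq))
  ... | no c≢0 = ⊥-elim (v∉ws (∈⟨⟩-by-dependency {c′ = c′} c≢0 eq))

  dependent⇒¬independent : ∀ {n k} {ws : Vec (Vector n) k} → Dependent ws → ¬ Independent ws
  dependent⇒¬independent (c , c≢0 , eq) ws-indep = c≢0 (ws-indep c eq)

  independent-⊆⟨⟩⇒⊇ : ∀ {n k} {ws bs : Vec (Vector n) k} → Independent ws → ws ⊆⟨ bs ⟩ →
                      ∀ {v} → v ∈⟨ bs ⟩ → v ∈⟨ ws ⟩
  independent-⊆⟨⟩⇒⊇ {k = k} {ws} {bs} ws-indep ws⊆bs {v} v∈bs with v ∈⟨ ws ⟩?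
  ... | yes v∈ws = v∈ws
  ... | no v∉ws = ⊥-elim (dependent⇒¬independent
          (more-vectors-than-span⇒dependent k (v ∷ ws) bs λ { zero → v∈bs ; (suc i) → ws⊆bs i })
          (independent-∷ v∉ws ws-indep))

module Subspaces {q : ℕ} (F : FiniteField q) (n : ℕ) where
  open VectorSpace F
  open Geometry F n using (Sub; basis; indep; _⊆_; _≈_; Count)

  ⊆-trans : ∀ {j k l} (S : Sub j) (T : Sub k) (U : Sub l) → S ⊆ T → T ⊆ U → S ⊆ U
  ⊆-trans S T U S⊆T T⊆U i = ∈⟨⟩-trans {ws = basis T} {vs = basis U} (S⊆T i) T⊆U

  ≈-sym : ∀ {k} (S T : Sub k) → S ≈ T → T ≈ S
  ≈-sym S T (S⊆T , T⊆S) = T⊆S , S⊆T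

  ≈-trans : ∀ {k} (S T U : Sub k) → S ≈ T → T ≈ U → S ≈ U
  ≈-trans S T U (S⊆T , T⊆S) (T⊆U , U⊆T) = ⊆-trans S T U S⊆T T⊆U , ⊆-trans U T S U⊆T T⊆S

  _⊆?_ : ∀ {j k} (S : Sub j) (T : Sub k) → Dec (S ⊆ T)
  S ⊆? T = FinP.all? (λ i → lookup (basis S) i ∈⟨ basis T ⟩?)

  _≈?_ : ∀ {k} (S T : Sub k) → Dec (S ≈ T)
  S ≈? T with S ⊆? T | T ⊆? S
  ... | yes S⊆T | yes T⊆S = yes (S⊆T , T⊆S)
  ... | no S⊈T  | _       = no (S⊈T ∘ proj₁)
  ... | _       | no T⊈S  = no (T⊈S ∘ proj₂)

  ⊆⇒≈ : ∀ {k} (S T : Sub k) → S ⊆ T → S ≈ T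
  ⊆⇒≈ S T S⊆T = S⊆T , λ i →
    independent-⊆⟨⟩⇒⊇ {ws = basis S} {bs = basis T} (indep S) S⊆T (⊆⟨⟩-refl (basis T) i)

  two-hyperplanes⇒≈ : ∀ {k} (S T : Sub (ℕ.suc k)) (g h : Sub k) →
                      g ⊆ S → h ⊆ S → g ⊆ T → h ⊆ T → ¬ g ≈ h → S ≈ T
  two-hyperplanes⇒≈ {k} S T g h g⊆S h⊆S g⊆T h⊆T g≉h = ⊆⇒≈ S T S⊆T
    where
    h⊈g : ¬ h ⊆ g
    h⊈g h⊆g = g≉h (≈-sym h g (⊆⇒≈ h g h⊆g))
    new-vector : ∃ λ i → ¬ lookup (basis h) i ∈⟨ basis g ⟩
    new-vector = FinP.¬∀⟶∃¬ k _ (λ i → lookup (basis h) i ∈⟨ basis g ⟩?) h⊈g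
    B : Vec (Vector n) (ℕ.suc k)
    B = lookup (basis h) (proj₁ new-vector) ∷ basis g
    B⊆ : (U : Sub (ℕ.suc k)) → g ⊆ U → h ⊆ U → B ⊆⟨ basis U ⟩
    B⊆ U g⊆U h⊆U zero = h⊆U (proj₁ new-vector)
    B⊆ U g⊆U h⊆U (suc i) = g⊆U i
    B-indep : Independent B
    B-indep = independent-∷ {ws = basis g} (proj₂ new-vector) (indep g)
    S⊆T : S ⊆ T
    S⊆T i = ∈⟨⟩-trans {ws = B} {vs = basis T}
              (independent-⊆⟨⟩⇒⊇ {ws = B} {bs = basis S} B-indep (B⊆ S g⊆S h⊆S) (⊆⟨⟩-refl (basis S) i))
              (B⊆ T g⊆T h⊆T)

  count-≤ : ∀ {k} {P Q : Sub k → Set} {a b} → Count P a → Count Q b → (∀ S → P S → Q S) → a ℕ.≤ b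
  count-≤ (Ps , Ps-ok , Ps-distinct , _) (Qs , _ , _ , Qs-complete) P⇒Q = FinP.injective⇒≤ f-injective
    where
    Q-index : ∀ i → ∃ λ j → lookup Ps i ≈ lookup Qs j
    Q-index i = Qs-complete (lookup Ps i) (P⇒Q _ (Ps-ok i))
    f-injective : ∀ {i i′} → proj₁ (Q-index i) ≡ proj₁ (Q-index i′) → i ≡ i′
    f-injective {i} {i′} same-j = Ps-distinct i i′
      (≈-trans (lookup Ps i) (lookup Qs (proj₁ (Q-index i′))) (lookup Ps i′)
        (subst (λ j → lookup Ps i ≈ lookup Qs j) same-j (proj₂ (Q-index i)))
        (≈-sym (lookup Ps i′) (lookup Qs (proj₁ (Q-index i′))) (proj₂ (Q-index i′))))

  count-unique : ∀ {k} {P : Sub k → Set} {a b} → Count P a → Count P b → a ≡ b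
  count-unique Pa Pb = NatP.≤-antisym (count-≤ Pa Pb (λ _ p → p)) (count-≤ Pb Pa (λ _ p → p))

  count-by-parametrisation : ∀ {k} {P : Sub k → Set} {A : Set} {N} (index : Fin N ↔ A) (φ : A → Sub k) →
    (∀ a → P (φ a)) → (∀ a b → φ a ≈ φ b → a ≡ b) → (∀ S → P S → ∃ λ a → S ≈ φ a) →
    Count P N
  count-by-parametrisation {P = P} index φ φ-ok φ-injective φ-complete = ss , ss-ok , ss-distinct , ss-complete
    where
    open Inverse index
    ss = tabulate (φ ∘ to)
    lookup-ss : ∀ i → lookup ss i ≡ φ (to i)
    lookup-ss = VecP.lookup∘tabulate (φ ∘ to)
    ss-ok : ∀ i → P (lookup ss i)
    ss-ok i = subst P (sym (lookup-ss i)) (φ-ok (to i))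
    ss-distinct : ∀ i j → lookup ss i ≈ lookup ss j → i ≡ j
    ss-distinct i j ssᵢ≈ssⱼ = begin
      i              ≡⟨ sym (strictlyInverseʳ i) ⟩
      from (to i)    ≡⟨ cong from (φ-injective (to i) (to j)
                                     (subst₂ _≈_ (lookup-ss i) (lookup-ss j) ssᵢ≈ssⱼ)) ⟩
      from (to j)    ≡⟨ strictlyInverseʳ j ⟩
      j              ∎
      where open ≡-Reasoning
    ss-complete : ∀ S → P S → ∃ λ i → S ≈ lookup ss i
    ss-complete S PS with φ-complete S PS
    ... | a , S≈φa = from a , subst (S ≈_) (sym (trans (lookup-ss (from a)) (cong φ (strictlyInverseˡ a)))) S≈φa

module EchelonForms {q : ℕ} (F : FiniteField q) where
  open VectorSpace F
  open FiniteField F using (0≢1; inverse)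
  open CommutativeRing ring
    using (_+_; _*_; -_; 0#; 1#; +-assoc; +-identityˡ; +-identityʳ; -‿inverseˡ; -‿inverseʳ;
           *-assoc; *-comm; *-identityˡ; *-identityʳ; zeroˡ; zeroʳ)
  open RingProperties (CommutativeRing.ring ring) using (-‿distribˡ-*; -‿involutive; -0#≈0#)

  -- Reduced row echelon forms of the 2-dimensional subspaces of F³, with pivot columns
  -- {1, 2}, {1, 3} and {2, 3} respectively.
  Echelon : Set
  Echelon = (Scalar × Scalar) ⊎ (Scalar ⊎ Fin 1)

  rows : Echelon → Vec (Vector 3) 2
  rows (inj₁ (a , b))  = (1# ∷ 0# ∷ a ∷ []) ∷ (0# ∷ 1# ∷ b ∷ []) ∷ []
  rows (inj₂ (inj₁ a)) = (1# ∷ a ∷ 0# ∷ []) ∷ (0# ∷ 0# ∷ 1# ∷ []) ∷ []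
  rows (inj₂ (inj₂ _)) = (0# ∷ 1# ∷ 0# ∷ []) ∷ (0# ∷ 0# ∷ 1# ∷ []) ∷ []

  HasEchelon : Vector 3 → Vector 3 → Set
  HasEchelon U V = ∃ λ e → rows e ⊆⟨ U ∷ V ∷ [] ⟩

  ≡-vec3 : ∀ {a b c a′ b′ c′ : Scalar} → a ≡ a′ → b ≡ b′ → c ≡ c′ →
           a ∷ b ∷ c ∷ [] ≡ a′ ∷ b′ ∷ c′ ∷ []
  ≡-vec3 refl refl refl = refl

  ≡-vec2 : ∀ {a b : Scalar} → a ≡ 0# → b ≡ 0# → a ∷ b ∷ [] ≡ 0ᵥ
  ≡-vec2 refl refl = refl

  vec3-≡ : ∀ {a b c a′ b′ c′ : Scalar} → a ∷ b ∷ c ∷ [] ≡ a′ ∷ b′ ∷ c′ ∷ [] →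
           (a ≡ a′) × (b ≡ b′) × (c ≡ c′)
  vec3-≡ refl = refl , refl , refl

  -- A coordinate of α U + β V as lincomb computes it.
  comb : Scalar → Scalar → Scalar → Scalar → Scalar
  comb α β x y = α * x + (β * y + 0#)

  comb-x1y0 : ∀ α β → comb α β 1# 0# ≡ α
  comb-x1y0 α β = trans (cong₂ _+_ (*-identityʳ α) (trans (+-identityʳ _) (zeroʳ β))) (+-identityʳ α)

  comb-x0y1 : ∀ α β → comb α β 0# 1# ≡ β
  comb-x0y1 α β = trans (cong₂ _+_ (zeroʳ α) (trans (+-identityʳ _) (*-identityʳ β))) (+-identityˡ β)

  comb-x0y0 : ∀ α β → comb α β 0# 0# ≡ 0#
  comb-x0y0 α β = trans (cong₂ _+_ (zeroʳ α) (trans (+-identityʳ _) (zeroʳ β))) (+-identityʳ 0#)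

  comb-y0 : ∀ α β x → comb α β x 0# ≡ α * x
  comb-y0 α β x = trans (cong (α * x +_) (trans (+-identityʳ _) (zeroʳ β))) (+-identityʳ _)

  comb-α1β0 : ∀ x y → comb 1# 0# x y ≡ x
  comb-α1β0 x y = trans (cong₂ _+_ (*-identityˡ x) (trans (+-identityʳ _) (zeroˡ y))) (+-identityʳ x)

  comb-α0β1 : ∀ x y → comb 0# 1# x y ≡ y
  comb-α0β1 x y = trans (cong₂ _+_ (zeroˡ x) (trans (+-identityʳ _) (*-identityˡ y))) (+-identityˡ y)

  comb-α0β0 : ∀ x y → comb 0# 0# x y ≡ 0#
  comb-α0β0 x y = trans (cong₂ _+_ (zeroˡ x) (trans (+-identityʳ _) (zeroˡ y))) (+-identityʳ 0#)

  1≢0 : 1# ≢ 0#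
  1≢0 = 0≢1 ∘ sym

  rows-independent : ∀ e → Independent (rows e)
  rows-independent (inj₁ (a , b)) (α ∷ β ∷ []) eq with vec3-≡ eq
  ... | e₁ , e₂ , _ = ≡-vec2 (trans (sym (comb-x1y0 α β)) e₁) (trans (sym (comb-x0y1 α β)) e₂)
  rows-independent (inj₂ (inj₁ a)) (α ∷ β ∷ []) eq with vec3-≡ eq
  ... | e₁ , _ , e₃ = ≡-vec2 (trans (sym (comb-x1y0 α β)) e₁) (trans (sym (comb-x0y1 α β)) e₃)
  rows-independent (inj₂ (inj₂ _)) (α ∷ β ∷ []) eq with vec3-≡ eq
  ... | _ , e₂ , e₃ = ≡-vec2 (trans (sym (comb-x1y0 α β)) e₂) (trans (sym (comb-x0y1 α β)) e₃)

  rows-unique : ∀ e e′ → rows e ⊆⟨ rows e′ ⟩ → e ≡ e′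
  rows-unique e e′ e⊆e′ = same-rows e e′ (e⊆e′ zero) (e⊆e′ (suc zero))
    where
    same-rows : ∀ e e′ → lookup (rows e) zero ∈⟨ rows e′ ⟩ → lookup (rows e) (suc zero) ∈⟨ rows e′ ⟩ →
                e ≡ e′
    same-rows (inj₁ (a , b)) (inj₁ (a′ , b′)) (α ∷ β ∷ [] , X) (α′ ∷ β′ ∷ [] , Y)
      with vec3-≡ X | vec3-≡ Y
    ... | X₁ , X₂ , X₃ | Y₁ , Y₂ , Y₃
      with trans (sym (comb-x1y0 α β)) X₁ | trans (sym (comb-x0y1 α β)) X₂
         | trans (sym (comb-x1y0 α′ β′)) Y₁ | trans (sym (comb-x0y1 α′ β′)) Y₂
    ... | refl | refl | refl | refl =
      cong inj₁ (cong₂ _,_ (trans (sym X₃) (comb-α1β0 a′ b′)) (trans (sym Y₃) (comb-α0β1 a′ b′)))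
    same-rows (inj₁ _) (inj₂ (inj₁ a′)) _ (α ∷ β ∷ [] , Y) with vec3-≡ Y
    ... | Y₁ , Y₂ , _ with trans (sym (comb-x1y0 α β)) Y₁
    ... | refl = ⊥-elim (1≢0 (trans (sym Y₂) (trans (comb-y0 0# β a′) (zeroˡ a′))))
    same-rows (inj₁ _) (inj₂ (inj₂ _)) (α ∷ β ∷ [] , X) _ =
      ⊥-elim (1≢0 (trans (sym (proj₁ (vec3-≡ X))) (comb-x0y0 α β)))
    same-rows (inj₂ (inj₁ _)) (inj₁ (a′ , b′)) _ (α ∷ β ∷ [] , Y) with vec3-≡ Y
    ... | Y₁ , Y₂ , Y₃ with trans (sym (comb-x1y0 α β)) Y₁ | trans (sym (comb-x0y1 α β)) Y₂
    ... | refl | refl = ⊥-elim (1≢0 (trans (sym Y₃) (comb-α0β0 a′ b′)))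
    same-rows (inj₂ (inj₁ a)) (inj₂ (inj₁ a′)) (α ∷ β ∷ [] , X) _ with vec3-≡ X
    ... | X₁ , X₂ , _ with trans (sym (comb-x1y0 α β)) X₁
    ... | refl = cong (inj₂ ∘ inj₁) (trans (sym X₂) (trans (comb-y0 1# β a′) (*-identityˡ a′)))
    same-rows (inj₂ (inj₁ _)) (inj₂ (inj₂ _)) (α ∷ β ∷ [] , X) _ =
      ⊥-elim (1≢0 (trans (sym (proj₁ (vec3-≡ X))) (comb-x0y0 α β)))
    same-rows (inj₂ (inj₂ _)) (inj₁ (a′ , b′)) _ (α ∷ β ∷ [] , Y) with vec3-≡ Y
    ... | Y₁ , Y₂ , Y₃ with trans (sym (comb-x1y0 α β)) Y₁ | trans (sym (comb-x0y1 α β)) Y₂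
    ... | refl | refl = ⊥-elim (1≢0 (trans (sym Y₃) (comb-α0β0 a′ b′)))
    same-rows (inj₂ (inj₂ _)) (inj₂ (inj₁ a′)) (α ∷ β ∷ [] , X) _ with vec3-≡ X
    ... | X₁ , X₂ , _ with trans (sym (comb-x1y0 α β)) X₁
    ... | refl = ⊥-elim (1≢0 (trans (sym X₂) (trans (comb-y0 0# β a′) (zeroˡ a′))))
    same-rows (inj₂ (inj₂ zero)) (inj₂ (inj₂ zero)) _ _ = refl

  inverseˡ : ∀ a → a ≢ 0# → ∃ λ s → s * a ≡ 1#
  inverseˡ a a≢0 with inverse a a≢0
  ... | s , a*s≡1 = s , trans (*-comm s a) a*s≡1

  x-x*1≡0 : ∀ x → x + - x * 1# ≡ 0#
  x-x*1≡0 x = trans (cong (x +_) (*-identityʳ (- x))) (-‿inverseʳ x)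

  x-y*0≡x : ∀ x y → x + - y * 0# ≡ x
  x-y*0≡x x y = trans (cong (x +_) (zeroʳ (- y))) (+-identityʳ x)

  x-y*z≡0⇒x≡y*z : ∀ x y z → x + - y * z ≡ 0# → x ≡ y * z
  x-y*z≡0⇒x≡y*z x y z eq = begin
    x                            ≡⟨ sym (+-identityʳ x) ⟩
    x + 0#                       ≡⟨ cong (x +_) (sym (-‿inverseˡ (y * z))) ⟩
    x + (- (y * z) + y * z)      ≡⟨ sym (+-assoc _ _ _) ⟩
    (x + - (y * z)) + y * z      ≡⟨ cong (λ w → (x + w) + y * z) (-‿distribˡ-* y z) ⟩
    (x + - y * z) + y * z        ≡⟨ cong (_+ y * z) eq ⟩
    0# + y * z                   ≡⟨ +-identityˡ _ ⟩
    y * z                        ∎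
    where open ≡-Reasoning

  x≡x*s*u : ∀ x {s u} → s * u ≡ 1# → x ≡ (x * s) * u
  x≡x*s*u x s*u≡1 = sym (trans (*-assoc x _ _) (trans (cong (x *_) s*u≡1) (*-identityʳ x)))

  0≡t*0 : ∀ {x u} t → x ≡ 0# → u ≡ 0# → x ≡ t * u
  0≡t*0 t refl refl = sym (zeroʳ t)

  -1≢0 : - 1# ≢ 0#
  -1≢0 -1≡0 = 1≢0 (trans (sym (-‿involutive 1#)) (trans (cong -_ -1≡0) -0#≈0#))

  independent⇒≢multiple : ∀ {U V : Vector 3} t → Independent (U ∷ V ∷ []) → V ≢ t · U
  independent⇒≢multiple {U} {V} t indep V≡tU =
    -1≢0 (VecP.∷-injectiveˡ (VecP.∷-injectiveʳ (indep (t ∷ - 1# ∷ []) (begin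
      t · U ⊕ ((- 1#) · V ⊕ 0ᵥ)    ≡⟨ cong (λ W → t · U ⊕ ((- 1#) · W ⊕ 0ᵥ)) V≡tU ⟩
      t · U ⊕ ((- 1#) · t · U ⊕ 0ᵥ) ≡⟨ cong (t · U ⊕_) (⊕-identityʳ _) ⟩
      t · U ⊖ t · U                 ≡⟨ ⊖-self (t · U) ⟩
      0ᵥ                            ∎))))
    where open ≡-Reasoning

  independent⇒≢0 : ∀ {U V : Vector 3} → Independent (U ∷ V ∷ []) → U ≢ 0ᵥ
  independent⇒≢0 {U} {V} indep U≡0 = 0≢1 (sym (VecP.∷-injectiveˡ (indep (1# ∷ 0# ∷ []) (begin
    1# · U ⊕ (0# · V ⊕ 0ᵥ)
      ≡⟨ cong₂ (λ W W′ → W ⊕ (W′ ⊕ 0ᵥ)) (trans (·-identityˡ U) U≡0) (·-zeroˡ V) ⟩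
    0ᵥ ⊕ (0ᵥ ⊕ 0ᵥ)           ≡⟨ trans (⊕-identityˡ _) (⊕-identityˡ 0ᵥ) ⟩
    0ᵥ                       ∎))))
    where open ≡-Reasoning

  lincomb-swap : ∀ {n} a b (U V : Vector n) →
                 lincomb (a ∷ b ∷ []) (V ∷ U ∷ []) ≡ lincomb (b ∷ a ∷ []) (U ∷ V ∷ [])
  lincomb-swap a b U V =
    trans (cong (a · V ⊕_) (⊕-identityʳ _)) (trans (⊕-comm _ _) (cong (b · U ⊕_) (sym (⊕-identityʳ _))))

  swap-⊆⟨⟩ : ∀ {U V : Vector 3} {k} (Xs : Vec (Vector 3) k) →
             Xs ⊆⟨ V ∷ U ∷ [] ⟩ → Xs ⊆⟨ U ∷ V ∷ [] ⟩
  swap-⊆⟨⟩ {U} {V} Xs Xs⊆ i with Xs⊆ i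
  ... | (a ∷ b ∷ [] , eq) = b ∷ a ∷ [] , trans (sym (lincomb-swap a b U V)) eq

  swap-independent : ∀ {U V : Vector 3} → Independent (U ∷ V ∷ []) → Independent (V ∷ U ∷ [])
  swap-independent {U} {V} indep (a ∷ b ∷ []) eq with indep (b ∷ a ∷ []) (trans (sym (lincomb-swap a b U V)) eq)
  ... | refl = refl

  module _ {u₁ u₂ u₃ v₁ v₂ v₃ : Scalar} where
    private
      U V : Vector 3
      U = u₁ ∷ u₂ ∷ u₃ ∷ []
      V = v₁ ∷ v₂ ∷ v₃ ∷ []

      _∈UV : Vector 3 → Set
      W ∈UV = W ∈⟨ U ∷ V ∷ [] ⟩

      U∈UV : U ∈UV
      U∈UV = ⊆⟨⟩-refl (U ∷ V ∷ []) zero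

      V∈UV : V ∈UV
      V∈UV = ⊆⟨⟩-refl (U ∷ V ∷ []) (suc zero)

      two-rows : ∀ e → lookup (rows e) zero ∈UV → lookup (rows e) (suc zero) ∈UV →
                 rows e ⊆⟨ U ∷ V ∷ [] ⟩
      two-rows e r₁ r₂ zero = r₁
      two-rows e r₁ r₂ (suc zero) = r₂

    echelon-pivot₁ : Independent (U ∷ V ∷ []) → u₁ ≢ 0# → HasEchelon U V
    echelon-pivot₁ indep u₁≢0 = by-c (c Fin.≟ 0#)
      where
      s = proj₁ (inverseˡ u₁ u₁≢0)
      a = s * u₂
      b = s * u₃
      A∈ : (1# ∷ a ∷ b ∷ []) ∈UV
      A∈ = subst _∈UV (≡-vec3 (proj₂ (inverseˡ u₁ u₁≢0)) refl refl) (∈⟨⟩-· s U∈UV)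
      c = v₂ + - v₁ * a
      d = v₃ + - v₁ * b
      V′∈ : (0# ∷ c ∷ d ∷ []) ∈UV
      V′∈ = subst _∈UV (≡-vec3 (x-x*1≡0 v₁) refl refl) (∈⟨⟩-⊕ V∈UV (∈⟨⟩-· (- v₁) A∈))
      by-c : Dec (c ≡ 0#) → HasEchelon U V
      by-c (no c≢0) = inj₁ (b + - a * e , e) , two-rows (inj₁ (b + - a * e , e)) U″∈ V″∈
        where
        t = proj₁ (inverseˡ c c≢0)
        e = t * d
        V″∈ : (0# ∷ 1# ∷ e ∷ []) ∈UV
        V″∈ = subst _∈UV (≡-vec3 (zeroʳ t) (proj₂ (inverseˡ c c≢0)) refl) (∈⟨⟩-· t V′∈)
        U″∈ : (1# ∷ 0# ∷ b + - a * e ∷ []) ∈UV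
        U″∈ = subst _∈UV (≡-vec3 (x-y*0≡x 1# a) (x-x*1≡0 a) refl)
                    (∈⟨⟩-⊕ A∈ (∈⟨⟩-· (- a) V″∈))
      by-c (yes c≡0) = by-d (d Fin.≟ 0#)
        where
        by-d : Dec (d ≡ 0#) → HasEchelon U V
        by-d (no d≢0) = inj₂ (inj₁ a) , two-rows (inj₂ (inj₁ a)) U″∈ V″∈
          where
          t = proj₁ (inverseˡ d d≢0)
          V″∈ : (0# ∷ 0# ∷ 1# ∷ []) ∈UV
          V″∈ = subst _∈UV (≡-vec3 (zeroʳ t) (trans (cong (t *_) c≡0) (zeroʳ t)) (proj₂ (inverseˡ d d≢0)))
                      (∈⟨⟩-· t V′∈)
          U″∈ : (1# ∷ a ∷ 0# ∷ []) ∈UV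
          U″∈ = subst _∈UV (≡-vec3 (x-y*0≡x 1# b) (x-y*0≡x a b) (x-x*1≡0 b))
                      (∈⟨⟩-⊕ A∈ (∈⟨⟩-· (- b) V″∈))
        by-d (yes d≡0) = ⊥-elim (independent⇒≢multiple (v₁ * s) indep (≡-vec3
          (x≡x*s*u v₁ (proj₂ (inverseˡ u₁ u₁≢0)))
          (trans (x-y*z≡0⇒x≡y*z v₂ v₁ a c≡0) (sym (*-assoc v₁ s u₂)))
          (trans (x-y*z≡0⇒x≡y*z v₃ v₁ b d≡0) (sym (*-assoc v₁ s u₃)))))

    echelon-pivot₂ : Independent (U ∷ V ∷ []) → u₁ ≡ 0# → v₁ ≡ 0# → u₂ ≢ 0# → HasEchelon U V
    echelon-pivot₂ indep u₁≡0 v₁≡0 u₂≢0 = by-d (d Fin.≟ 0#)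
      where
      s = proj₁ (inverseˡ u₂ u₂≢0)
      b = s * u₃
      A∈ : (0# ∷ 1# ∷ b ∷ []) ∈UV
      A∈ = subst _∈UV (≡-vec3 (trans (cong (s *_) u₁≡0) (zeroʳ s)) (proj₂ (inverseˡ u₂ u₂≢0)) refl)
                 (∈⟨⟩-· s U∈UV)
      d = v₃ + - v₂ * b
      V′∈ : (0# ∷ 0# ∷ d ∷ []) ∈UV
      V′∈ = subst _∈UV (≡-vec3 (trans (x-y*0≡x v₁ v₂) v₁≡0) (x-x*1≡0 v₂) refl)
                  (∈⟨⟩-⊕ V∈UV (∈⟨⟩-· (- v₂) A∈))
      by-d : Dec (d ≡ 0#) → HasEchelon U V
      by-d (no d≢0) = inj₂ (inj₂ zero) , two-rows (inj₂ (inj₂ zero)) U″∈ V″∈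
        where
        t = proj₁ (inverseˡ d d≢0)
        V″∈ : (0# ∷ 0# ∷ 1# ∷ []) ∈UV
        V″∈ = subst _∈UV (≡-vec3 (zeroʳ t) (zeroʳ t) (proj₂ (inverseˡ d d≢0))) (∈⟨⟩-· t V′∈)
        U″∈ : (0# ∷ 1# ∷ 0# ∷ []) ∈UV
        U″∈ = subst _∈UV (≡-vec3 (x-y*0≡x 0# b) (x-y*0≡x 1# b) (x-x*1≡0 b))
                    (∈⟨⟩-⊕ A∈ (∈⟨⟩-· (- b) V″∈))
      by-d (yes d≡0) = ⊥-elim (independent⇒≢multiple (v₂ * s) indep (≡-vec3
        (0≡t*0 (v₂ * s) v₁≡0 u₁≡0)
        (x≡x*s*u v₂ (proj₂ (inverseˡ u₂ u₂≢0)))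
        (trans (x-y*z≡0⇒x≡y*z v₃ v₂ b d≡0) (sym (*-assoc v₂ s u₃)))))

    no-pivot-dependent : Independent (U ∷ V ∷ []) → u₁ ≡ 0# → v₁ ≡ 0# → u₂ ≡ 0# → v₂ ≡ 0# → ⊥
    no-pivot-dependent indep u₁≡0 v₁≡0 u₂≡0 v₂≡0 with u₃ Fin.≟ 0#
    ... | yes u₃≡0 = independent⇒≢0 indep (≡-vec3 u₁≡0 u₂≡0 u₃≡0)
    ... | no u₃≢0 = independent⇒≢multiple (v₃ * s) indep
          (≡-vec3 (0≡t*0 (v₃ * s) v₁≡0 u₁≡0) (0≡t*0 (v₃ * s) v₂≡0 u₂≡0)
                  (x≡x*s*u v₃ (proj₂ (inverseˡ u₃ u₃≢0))))
      where s = proj₁ (inverseˡ u₃ u₃≢0)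

  swap-echelon : ∀ {U V} → HasEchelon V U → HasEchelon U V
  swap-echelon (e , e⊆) = e , swap-⊆⟨⟩ (rows e) e⊆

  echelon-exists : ∀ U V → Independent (U ∷ V ∷ []) → HasEchelon U V
  echelon-exists (u₁ ∷ u₂ ∷ u₃ ∷ []) (v₁ ∷ v₂ ∷ v₃ ∷ []) indep with u₁ Fin.≟ 0# | v₁ Fin.≟ 0#
  ... | no u₁≢0 | _       = echelon-pivot₁ indep u₁≢0
  ... | yes _   | no v₁≢0 = swap-echelon (echelon-pivot₁ (swap-independent indep) v₁≢0)
  ... | yes u₁≡0 | yes v₁≡0 with u₂ Fin.≟ 0# | v₂ Fin.≟ 0#
  ... | no u₂≢0 | _       = echelon-pivot₂ indep u₁≡0 v₁≡0 u₂≢0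
  ... | yes _   | no v₂≢0 = swap-echelon (echelon-pivot₂ (swap-independent indep) v₁≡0 u₁≡0 v₂≢0)
  ... | yes u₂≡0 | yes v₂≡0 = ⊥-elim (no-pivot-dependent indep u₁≡0 v₁≡0 u₂≡0 v₂≡0)

module LinesOfPlane {q : ℕ} (F : FiniteField q) (n : ℕ) (π : Geometry.Sub F n 3) where
  open VectorSpace F
  open EchelonForms F
  open Subspaces F n
  open Geometry F n using (Sub; sub; basis; indep; _⊆_; _≈_; Count)
  open CommutativeRing ring using (-_; 1#)

  ⟦_⟧ : Vector 3 → Vector n
  ⟦ Z ⟧ = lincomb Z (basis π)

  ⟦⟧-injective : ∀ {Z Z′} → ⟦ Z ⟧ ≡ ⟦ Z′ ⟧ → Z ≡ Z′
  ⟦⟧-injective {Z} {Z′} ⟦Z⟧≡⟦Z′⟧ = ⊖≡0⇒≡ Z Z′ (indep π (Z ⊖ Z′) (begin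
    lincomb (Z ⊖ Z′) (basis π)
      ≡⟨ lincomb-⊕ Z ((- 1#) · Z′) (basis π) ⟩
    ⟦ Z ⟧ ⊕ lincomb ((- 1#) · Z′) (basis π)
      ≡⟨ cong₂ _⊕_ ⟦Z⟧≡⟦Z′⟧ (lincomb-· (- 1#) Z′ (basis π)) ⟩
    ⟦ Z′ ⟧ ⊖ ⟦ Z′ ⟧
      ≡⟨ ⊖-self ⟦ Z′ ⟧ ⟩
    0ᵥ ∎))
    where open ≡-Reasoning

  ∈⟨⟩⇒∈⟨⟦⟧⟩ : ∀ {k Z} (Xs : Vec (Vector 3) k) → Z ∈⟨ Xs ⟩ → ⟦ Z ⟧ ∈⟨ map ⟦_⟧ Xs ⟩
  ∈⟨⟩⇒∈⟨⟦⟧⟩ Xs (as , refl) = as , lincomb-lincomb as Xs (basis π)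

  ∈⟨⟦⟧⟩⇒∈⟨⟩ : ∀ {k Z} (Xs : Vec (Vector 3) k) → ⟦ Z ⟧ ∈⟨ map ⟦_⟧ Xs ⟩ → Z ∈⟨ Xs ⟩
  ∈⟨⟦⟧⟩⇒∈⟨⟩ Xs (as , eq) = as , ⟦⟧-injective (trans (sym (lincomb-lincomb as Xs (basis π))) eq)

  independent-⟦⟧ : ∀ {k} (Xs : Vec (Vector 3) k) → Independent Xs → Independent (map ⟦_⟧ Xs)
  independent-⟦⟧ Xs Xs-indep cs eq = Xs-indep cs (⟦⟧-injective
    (trans (sym (lincomb-lincomb cs Xs (basis π))) (trans eq (sym (lincomb-zero (basis π))))))

  echelon-line : Echelon → Sub 2
  echelon-line e = sub (map ⟦_⟧ (rows e)) (independent-⟦⟧ (rows e) (rows-independent e))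

  echelon-line-⊆ : ∀ e → echelon-line e ⊆ π
  echelon-line-⊆ e i = lookup (rows e) i , sym (VecP.lookup-map i ⟦_⟧ (rows e))

  echelon-line-injective : ∀ e e′ → echelon-line e ≈ echelon-line e′ → e ≡ e′
  echelon-line-injective e e′ (e⊆e′ , _) = rows-unique e e′ λ i →
    ∈⟨⟦⟧⟩⇒∈⟨⟩ (rows e′)
      (subst (_∈⟨ map ⟦_⟧ (rows e′) ⟩) (VecP.lookup-map i ⟦_⟧ (rows e)) (e⊆e′ i))

  echelon-line-complete : ∀ (g : Sub 2) → g ⊆ π → ∃ λ e → g ≈ echelon-line e
  echelon-line-complete g g⊆π = e , ≈-sym (echelon-line e) g (⊆⇒≈ (echelon-line e) g e⊆g)
    where
    U = proj₁ (g⊆π zero)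
    V = proj₁ (g⊆π (suc zero))
    basis-g : basis g ≡ map ⟦_⟧ (U ∷ V ∷ [])
    basis-g = trans (sym (VecP.tabulate∘lookup (basis g)))
                    (cong₂ (λ a b → a ∷ b ∷ []) (sym (proj₂ (g⊆π zero))) (sym (proj₂ (g⊆π (suc zero)))))
    UV-indep : Independent (U ∷ V ∷ [])
    UV-indep cs eq = indep g cs (begin
      lincomb cs (basis g)                   ≡⟨ cong (lincomb cs) basis-g ⟩
      lincomb cs (map ⟦_⟧ (U ∷ V ∷ []))      ≡⟨ lincomb-lincomb cs (U ∷ V ∷ []) (basis π) ⟩
      ⟦ lincomb cs (U ∷ V ∷ []) ⟧            ≡⟨ cong ⟦_⟧ eq ⟩
      ⟦ 0ᵥ ⟧                                 ≡⟨ lincomb-zero (basis π) ⟩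
      0ᵥ                                     ∎)
      where open ≡-Reasoning
    e = proj₁ (echelon-exists U V UV-indep)
    e⊆g : echelon-line e ⊆ g
    e⊆g i = subst (lookup (map ⟦_⟧ (rows e)) i ∈⟨_⟩) (sym basis-g)
      (subst (_∈⟨ map ⟦_⟧ (U ∷ V ∷ []) ⟩) (sym (VecP.lookup-map i ⟦_⟧ (rows e)))
        (∈⟨⟩⇒∈⟨⟦⟧⟩ (U ∷ V ∷ []) (proj₂ (echelon-exists U V UV-indep) i)))

  echelon-index : Fin (q ℕ.* q ℕ.+ (q ℕ.+ 1)) ↔ Echelon
  echelon-index = ↔-trans FinP.+↔⊎ (FinP.*↔× ⊎-↔ FinP.+↔⊎)

  lines-of-plane : Count (_⊆ π) (q ℕ.* q ℕ.+ (q ℕ.+ 1))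
  lines-of-plane = count-by-parametrisation echelon-index echelon-line
    echelon-line-⊆ echelon-line-injective echelon-line-complete

module DecidableCounting where
  open import Algebra.Properties.CommutativeMonoid.Sum NatP.+-0-commutativeMonoid public
    using (sum; ∑-comm; sum-cong-≗)

  indicator : ∀ {A : Set} → Dec A → ℕ
  indicator (yes _) = 1
  indicator (no _) = 0

  count : ∀ {N} {P : Fin N → Set} → (∀ j → Dec (P j)) → ℕ
  count P? = sum (indicator ∘ P?)

  sum-suc : ∀ {N} (f : Fin N → ℕ) → sum (ℕ.suc ∘ f) ≡ N ℕ.+ sum f
  sum-suc {ℕ.zero} f = refl
  sum-suc {ℕ.suc N} f = cong ℕ.suc (begin
    f zero ℕ.+ sum (ℕ.suc ∘ f ∘ suc)   ≡⟨ cong (f zero ℕ.+_) (sum-suc (f ∘ suc)) ⟩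
    f zero ℕ.+ (N ℕ.+ sum (f ∘ suc))   ≡⟨ NatP.+-comm (f zero) _ ⟩
    (N ℕ.+ sum (f ∘ suc)) ℕ.+ f zero   ≡⟨ NatP.+-assoc N _ (f zero) ⟩
    N ℕ.+ (sum (f ∘ suc) ℕ.+ f zero)   ≡⟨ cong (N ℕ.+_) (NatP.+-comm _ (f zero)) ⟩
    N ℕ.+ sum f                        ∎)
    where open ≡-Reasoning

  sum-ones : ∀ N → sum {N} (λ _ → 1) ≡ N
  sum-ones ℕ.zero = refl
  sum-ones (ℕ.suc N) = cong ℕ.suc (sum-ones N)

  count-none : ∀ {N} {P : Fin N → Set} (P? : ∀ j → Dec (P j)) → (∀ j → ¬ P j) → count P? ≡ 0
  count-none {ℕ.zero} P? ¬P = refl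
  count-none {ℕ.suc N} P? ¬P with P? zero
  ... | yes p = ⊥-elim (¬P zero p)
  ... | no _ = count-none (P? ∘ suc) (¬P ∘ suc)

  count-single : ∀ {N} {P : Fin N → Set} (P? : ∀ j → Dec (P j)) j₀ → P j₀ → (∀ j → P j → j ≡ j₀) →
                 count P? ≡ 1
  count-single P? zero p₀ only-j₀ with P? zero
  ... | yes _ = cong ℕ.suc (count-none (P? ∘ suc) (λ j p → FinP.0≢1+n (sym (only-j₀ (suc j) p))))
  ... | no ¬p₀ = ⊥-elim (¬p₀ p₀)
  count-single P? (suc j₀) p₀ only-j₀ with P? zero
  ... | yes p = ⊥-elim (FinP.0≢1+n (only-j₀ zero p))
  ... | no _ = count-single (P? ∘ suc) j₀ p₀ (λ j p → FinP.suc-injective (only-j₀ (suc j) p))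

  record Enumeration {N} (P : Fin N → Set) (size : ℕ) : Set where
    field
      index            : Fin size → Fin N
      index-satisfies  : ∀ i → P (index i)
      index-injective  : ∀ i i′ → index i ≡ index i′ → i ≡ i′
      index-surjective : ∀ j → P j → ∃ λ i → index i ≡ j

  extend : ∀ {N} {P : Fin (ℕ.suc N) → Set} {k} (P₀? : Dec (P zero)) → Enumeration (P ∘ suc) k →
           Enumeration P (indicator P₀? ℕ.+ k)
  extend {P = P} (yes p₀) E = record
    { index = index′ ; index-satisfies = satisfies ; index-injective = injective ; index-surjective = surjective }
    where
    open Enumeration E
    index′ : Fin (ℕ.suc _) → Fin (ℕ.suc _)
    index′ zero = zero
    index′ (suc i) = suc (index i)
    satisfies : ∀ i → P (index′ i)
    satisfies zero = p₀
    satisfies (suc i) = index-satisfies i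
    injective : ∀ i i′ → index′ i ≡ index′ i′ → i ≡ i′
    injective zero zero _ = refl
    injective zero (suc i′) ()
    injective (suc i) zero ()
    injective (suc i) (suc i′) eq = cong suc (index-injective i i′ (FinP.suc-injective eq))
    surjective : ∀ j → P j → ∃ λ i → index′ i ≡ j
    surjective zero _ = zero , refl
    surjective (suc j) p = Data.Product.map suc (cong suc) (index-surjective j p)
  extend {P = P} (no ¬p₀) E = record
    { index = suc ∘ index ; index-satisfies = index-satisfies
    ; index-injective = λ i i′ → index-injective i i′ ∘ FinP.suc-injective
    ; index-surjective = surjective }
    where
    open Enumeration E
    surjective : ∀ j → P j → ∃ λ i → suc (index i) ≡ j
    surjective zero p = ⊥-elim (¬p₀ p)
    surjective (suc j) p = map₂ (cong suc) (index-surjective j p)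

  enumerate : ∀ {N} {P : Fin N → Set} (P? : ∀ j → Dec (P j)) → Enumeration P (count P?)
  enumerate {ℕ.zero} P? = record
    { index = λ () ; index-satisfies = λ () ; index-injective = λ () ; index-surjective = λ () }
  enumerate {ℕ.suc N} P? = extend (P? zero) (enumerate (P? ∘ suc))

open Int using (ℤ; +_)

module DoubleCounting {q : ℕ} (F : FiniteField q) (n : ℕ)
  (L : Geometry.Sub F n 3 → Set) (L-resp-≈ : ∀ {τ σ} → Geometry._≈_ F n τ σ → L τ → L σ)
  (π : Geometry.Sub F n 3) (Lπ : L π)
  {N : ℕ} (neighbours : Geometry.Count F n (λ σ → L σ × Geometry.MeetInLine F n π σ) N) where
  open Geometry F n using (Sub; _≈_; _⊆_; Count; MeetInLine; EnumLinesOf)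
  open Subspaces F n
  open DecidableCounting

  T : Vec (Sub 3) N
  T = proj₁ neighbours

  T-neighbour : ∀ j → L (lookup T j) × MeetInLine π (lookup T j)
  T-neighbour = proj₁ (proj₂ neighbours)

  T-distinct : ∀ j j′ → lookup T j ≈ lookup T j′ → j ≡ j′
  T-distinct = proj₁ (proj₂ (proj₂ neighbours))

  T-complete : ∀ σ → L σ × MeetInLine π σ → ∃ λ j → σ ≈ lookup T j
  T-complete = proj₂ (proj₂ (proj₂ neighbours))

  _⊆T? : (g : Sub 2) → ∀ j → Dec (g ⊆ lookup T j)
  (g ⊆T?) j = g ⊆? lookup T j

  π≉T : ∀ j → ¬ π ≈ lookup T j
  π≉T j = proj₂ (proj₂ (T-neighbour j))

  planes-through : ∀ (g : Sub 2) → g ⊆ π → Count (λ τ → L τ × g ⊆ τ) (ℕ.suc (count (g ⊆T?)))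
  planes-through g g⊆π = planes , satisfies , distinct , complete
    where
    open Enumeration (enumerate (g ⊆T?))
    planes : Vec (Sub 3) (ℕ.suc (count (g ⊆T?)))
    planes = π ∷ tabulate (lookup T ∘ index)
    lookup-planes : ∀ i → lookup planes (suc i) ≡ lookup T (index i)
    lookup-planes = VecP.lookup∘tabulate (lookup T ∘ index)
    satisfies : ∀ i → L (lookup planes i) × g ⊆ lookup planes i
    satisfies zero = Lπ , g⊆π
    satisfies (suc i) = subst (λ τ → L τ × g ⊆ τ) (sym (lookup-planes i))
                              (proj₁ (T-neighbour (index i)) , index-satisfies i)
    distinct : ∀ i i′ → lookup planes i ≈ lookup planes i′ → i ≡ i′
    distinct zero zero _ = refl
    distinct zero (suc i′) π≈ = ⊥-elim (π≉T (index i′) (subst (π ≈_) (lookup-planes i′) π≈))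
    distinct (suc i) zero ≈π = ⊥-elim (π≉T (index i)
      (≈-sym (lookup T (index i)) π (subst (_≈ π) (lookup-planes i) ≈π)))
    distinct (suc i) (suc i′) ≈′ = cong suc (index-injective i i′
      (T-distinct (index i) (index i′) (subst₂ _≈_ (lookup-planes i) (lookup-planes i′) ≈′)))
    complete : ∀ τ → L τ × g ⊆ τ → ∃ λ i → τ ≈ lookup planes i
    complete τ (Lτ , g⊆τ) with τ ≈? π
    ... | yes τ≈π = zero , τ≈π
    ... | no τ≉π with T-complete τ (Lτ , (g , g⊆π , g⊆τ) , τ≉π ∘ ≈-sym π τ)
    ... | j , τ≈Tj with index-surjective j (⊆-trans g τ (lookup T j) g⊆τ (proj₁ τ≈Tj))
    ... | i , refl = suc i , subst (τ ≈_) (sym (lookup-planes i)) τ≈Tj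

  L?-through : ∀ (g : Sub 2) → g ⊆ π → ∀ τ → g ⊆ τ → Dec (L τ)
  L?-through g g⊆π τ g⊆τ with τ ≈? π
  ... | yes τ≈π = yes (L-resp-≈ (≈-sym τ π τ≈π) Lπ)
  ... | no τ≉π with FinP.any? (λ j → τ ≈? lookup T j)
  ... | yes (j , τ≈Tj) = yes (L-resp-≈ (≈-sym τ (lookup T j) τ≈Tj) (proj₁ (T-neighbour j)))
  ... | no τ∉T = no λ Lτ → τ∉T (T-complete τ (Lτ , (g , g⊆π , g⊆τ) , τ≉π ∘ ≈-sym π τ))

  through-plane-not-in-L : ∀ (g : Sub 2) → g ⊆ π → ∀ τ → g ⊆ τ → ¬ L τ →
    ∀ {c} → Count (λ σ → L σ × MeetInLine τ σ) c → ℕ.suc (count (g ⊆T?)) ℕ.≤ c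
  through-plane-not-in-L g g⊆π τ g⊆τ ¬Lτ τ-neighbours =
    count-≤ (planes-through g g⊆π) τ-neighbours
      λ σ (Lσ , g⊆σ) → Lσ , (g , g⊆τ , g⊆σ) , λ τ≈σ → ¬Lτ (L-resp-≈ (≈-sym τ σ τ≈σ) Lσ)

  -- The bound is decidable; were it false, every plane through g would lie in L.
  non-full-line-bound : ∀ (x : ℤ) →
    (∀ τ → ¬ L τ → Σ[ c ∈ ℕ ] (Count (λ σ → L σ × MeetInLine τ σ) c × (+ c ≡ x))) →
    ∀ (g : Sub 2) → g ⊆ π → ¬ (∀ τ → g ⊆ τ → L τ) → + ℕ.suc (count (g ⊆T?)) Int.≤ x
  non-full-line-bound x non-L-neighbours g g⊆π not-full =
    decidable-stable (_ IntP.≤? x) λ bound-fails → not-full λ τ g⊆τ →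
      decidable-stable (L?-through g g⊆π τ g⊆τ) λ ¬Lτ →
        let c , τ-neighbours , c≡x = non-L-neighbours τ ¬Lτ
        in bound-fails (subst (_ Int.≤_) c≡x
                         (Int.+≤+ (through-plane-not-in-L g g⊆π τ g⊆τ ¬Lτ τ-neighbours)))

  module _ {m} (gs : Vec (Sub 2) m) (gs-lines : EnumLinesOf π gs) where
    private
      gs⊆π = proj₁ gs-lines
      gs-distinct = proj₁ (proj₂ gs-lines)
      gs-complete = proj₂ (proj₂ gs-lines)

    neighbour-contains-one-line : ∀ j → count (λ i → (lookup gs i ⊆T?) j) ≡ 1
    neighbour-contains-one-line j = count-single (λ i → (lookup gs i ⊆T?) j) i₀ gᵢ₀⊆Tⱼ only-i₀
      where
      common-line = proj₁ (proj₂ (T-neighbour j))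
      h = proj₁ common-line
      i₀ = proj₁ (gs-complete h (proj₁ (proj₂ common-line)))
      gᵢ₀⊆Tⱼ : lookup gs i₀ ⊆ lookup T j
      gᵢ₀⊆Tⱼ = ⊆-trans (lookup gs i₀) h (lookup T j)
                 (proj₂ (proj₂ (gs-complete h (proj₁ (proj₂ common-line))))) (proj₂ (proj₂ common-line))
      only-i₀ : ∀ i → lookup gs i ⊆ lookup T j → i ≡ i₀
      only-i₀ i gᵢ⊆Tⱼ with i FinP.≟ i₀
      ... | yes i≡i₀ = i≡i₀
      ... | no i≢i₀ = ⊥-elim (π≉T j (two-hyperplanes⇒≈ π (lookup T j) (lookup gs i) (lookup gs i₀)
                        (gs⊆π i) (gs⊆π i₀) gᵢ⊆Tⱼ gᵢ₀⊆Tⱼ (i≢i₀ ∘ gs-distinct i i₀)))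

    through-counts : Vec ℕ m
    through-counts = tabulate (λ i → ℕ.suc (count (lookup gs i ⊆T?)))

    lookup-through-counts : ∀ i → lookup through-counts i ≡ ℕ.suc (count (lookup gs i ⊆T?))
    lookup-through-counts = VecP.lookup∘tabulate (λ i → ℕ.suc (count (lookup gs i ⊆T?)))

    through-counts-count : ∀ i → Count (λ τ → L τ × lookup gs i ⊆ τ) (lookup through-counts i)
    through-counts-count i =
      subst (Count _) (sym (lookup-through-counts i)) (planes-through (lookup gs i) (gs⊆π i))

    through-counts-≤ : ∀ (x : ℤ) →
      (∀ τ → ¬ L τ → Σ[ c ∈ ℕ ] (Count (λ σ → L σ × MeetInLine τ σ) c × (+ c ≡ x))) →
      (∀ (g : Sub 2) → g ⊆ π → ¬ (∀ τ → g ⊆ τ → L τ)) → ∀ i → + lookup through-counts i Int.≤ x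
    through-counts-≤ x non-L-neighbours no-full-line i =
      subst (λ c → + c Int.≤ x) (sym (lookup-through-counts i)) (non-full-line-bound x non-L-neighbours (lookup gs i) (gs⊆π i) (no-full-line (lookup gs i) (gs⊆π i)))

    line-counts-sum : (cs : Vec ℕ m) → (∀ i → Count (λ τ → L τ × lookup gs i ⊆ τ) (lookup cs i)) →
                      sum (lookup cs) ≡ m ℕ.+ N
    line-counts-sum cs cs-count = begin
      sum (lookup cs)
        ≡⟨ sum-cong-≗ (λ i → count-unique (cs-count i) (planes-through (lookup gs i) (gs⊆π i))) ⟩
      sum (λ i → ℕ.suc (count (lookup gs i ⊆T?)))
        ≡⟨ sum-suc (λ i → count (lookup gs i ⊆T?)) ⟩
      m ℕ.+ sum (λ i → count (lookup gs i ⊆T?))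
        ≡⟨ cong (m ℕ.+_) (∑-comm (λ i j → indicator ((lookup gs i ⊆T?) j))) ⟩
      m ℕ.+ sum (λ j → count (λ i → (lookup gs i ⊆T?) j))
        ≡⟨ cong (m ℕ.+_) (sum-cong-≗ neighbour-contains-one-line) ⟩
      m ℕ.+ sum {N} (λ _ → 1)
        ≡⟨ cong (m ℕ.+_) (sum-ones N) ⟩
      m ℕ.+ N ∎
      where open ≡-Reasoning

module Arithmetic where
  open Int using (_≤_; _-_; _*_; _+_; 0ℤ; 1ℤ)
  open import Data.Nat.Solver using (module +-*-Solver)
  import Data.Integer.Tactic.RingSolver as ℤ-Solver
  open DecidableCounting using (sum)

  sumℤ-deficits : ∀ {m} x (cs : Vec ℕ m) → sumℤ (map (λ c → x - + c) cs) ≡ + m * x - + sum (lookup cs)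
  sumℤ-deficits x [] = sym (IntP.*-zeroˡ x)
  sumℤ-deficits {ℕ.suc m} x (c ∷ cs) = begin
    (x - + c) + sumℤ (map (λ c → x - + c) cs)
      ≡⟨ cong (λ s → (x - + c) + s) (sumℤ-deficits x cs) ⟩
    (x - + c) + (+ m * x - + s)
      ≡⟨ regroup x (+ c) (+ m) (+ s) ⟩
    (1ℤ + + m) * x - (+ c + + s)
      ≡⟨ sym (cong₂ (λ a b → a * x - b) (IntP.pos-+ 1 m) (IntP.pos-+ c s)) ⟩
    + ℕ.suc m * x - + (c ℕ.+ s) ∎
    where
    open ≡-Reasoning
    s = sum (lookup cs)
    regroup : ∀ x c m s → (x - c) + (m * x - s) ≡ (1ℤ + m) * x - (c + s)
    regroup = ℤ-Solver.solve-∀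

  sumℤ-deficits-nonneg : ∀ {m} x (cs : Vec ℕ m) → (∀ i → + lookup cs i ≤ x) →
                         0ℤ ≤ sumℤ (map (λ c → x - + c) cs)
  sumℤ-deficits-nonneg x [] _ = Int.+≤+ ℕ.z≤n
  sumℤ-deficits-nonneg x (c ∷ cs) cs≤x =
    IntP.+-mono-≤ (IntP.i≤j⇒0≤j-i (cs≤x zero)) (sumℤ-deficits-nonneg x cs (cs≤x ∘ suc))

  module _ (q : ℕ) where
    open +-*-Solver

    lines : ℕ
    lines = q ℕ.* q ℕ.+ (q ℕ.+ 1)

    offset : ℕ
    offset = q ℕ.* q ℕ.* (q ℕ.^ 3 ℕ.+ q ℕ.^ 2 ℕ.+ q ℕ.+ 1)

    offset+q+1 : offset ℕ.+ q ℕ.+ 1 ≡ (q ℕ.^ 5 ℕ.+ q ℕ.^ 4 ℕ.+ q ℕ.^ 3) ℕ.+ ((q ℕ.* q ℕ.+ q) ℕ.+ 1)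
    offset+q+1 = solve 1 (λ q → q :* q :* (q :^ 3 :+ q :^ 2 :+ q :+ con 1) :+ q :+ con 1
                         := (q :^ 5 :+ q :^ 4 :+ q :^ 3) :+ ((q :* q :+ q) :+ con 1)) refl q

    bound+offset : (q ℕ.* q ℕ.+ q) ℕ.* ((q ℕ.+ 1) ℕ.* (q ℕ.* q ℕ.+ q ℕ.+ 1))
                   ≡ q ℕ.* (q ℕ.+ 1) ℕ.* (2 ℕ.* q ℕ.* q ℕ.+ q ℕ.+ 1) ℕ.+ offset
    bound+offset = solve 1 (λ q → (q :* q :+ q) :* ((q :+ con 1) :* (q :* q :+ q :+ con 1))
      := q :* (q :+ con 1) :* (con 2 :* q :* q :+ q :+ con 1) :+ q :* q :* (q :^ 3 :+ q :^ 2 :+ q :+ con 1)) refl q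

    offset-factorisation : (q ℕ.* q ℕ.+ q) ℕ.* (q ℕ.^ 3 ℕ.+ q) ≡ offset
    offset-factorisation = solve 1 (λ q → (q :* q :+ q) :* (q :^ 3 :+ q)
      := q :* q :* (q :^ 3 :+ q :^ 2 :+ q :+ con 1)) refl q

    deficit-sum-closed-form : ∀ x N → + N ≡ λ₂ q + x →
      + lines * x - + (lines ℕ.+ N) ≡ + (q ℕ.* q ℕ.+ q) * x - + offset
    deficit-sum-closed-form x N N≡λ₂+x = begin
      + lines * x - + (lines ℕ.+ N)
        ≡⟨ cong₂ (λ l l′ → l * x - l′) lines≡P+1
                 (trans (IntP.pos-+ lines N) (cong₂ _+_ lines≡P+1 N≡λ₂+x)) ⟩
      (P + 1ℤ) * x - ((P + 1ℤ) + ((A - Q - 1ℤ) + x))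
        ≡⟨ cancel-x P A Q x ⟩
      P * x - (A + (P + 1ℤ) - Q - 1ℤ)
        ≡⟨ cong (λ k → P * x - (k - Q - 1ℤ)) (sym offset+q+1ℤ) ⟩
      P * x - (+ offset + Q + 1ℤ - Q - 1ℤ)
        ≡⟨ cancel-q+1 P (+ offset) Q x ⟩
      P * x - + offset ∎
      where
      open ≡-Reasoning
      P′ = q ℕ.* q ℕ.+ q
      A′ = q ℕ.^ 5 ℕ.+ q ℕ.^ 4 ℕ.+ q ℕ.^ 3
      P = + P′
      A = + A′
      Q = + q
      lines≡P+1 : + lines ≡ P + 1ℤ
      lines≡P+1 = trans (cong +_ (sym (NatP.+-assoc (q ℕ.* q) q 1))) (IntP.pos-+ P′ 1)
      offset+q+1ℤ : + offset + Q + 1ℤ ≡ A + (P + 1ℤ)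
      offset+q+1ℤ = begin
        + offset + Q + 1ℤ         ≡⟨ cong (_+ 1ℤ) (sym (IntP.pos-+ offset q)) ⟩
        + (offset ℕ.+ q) + 1ℤ     ≡⟨ sym (IntP.pos-+ (offset ℕ.+ q) 1) ⟩
        + (offset ℕ.+ q ℕ.+ 1)    ≡⟨ cong +_ offset+q+1 ⟩
        + (A′ ℕ.+ (P′ ℕ.+ 1))     ≡⟨ IntP.pos-+ A′ (P′ ℕ.+ 1) ⟩
        A + + (P′ ℕ.+ 1)          ≡⟨ cong (λ k → A + k) (IntP.pos-+ P′ 1) ⟩
        A + (P + 1ℤ)              ∎
      cancel-x : ∀ P A Q x → (P + 1ℤ) * x - ((P + 1ℤ) + ((A - Q - 1ℤ) + x)) ≡ P * x - (A + (P + 1ℤ) - Q - 1ℤ)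
      cancel-x = ℤ-Solver.solve-∀
      cancel-q+1 : ∀ P k Q x → P * x - (k + Q + 1ℤ - Q - 1ℤ) ≡ P * x - k
      cancel-q+1 = ℤ-Solver.solve-∀

    deficit-sum-≤ : ∀ x → x ≤ + ((q ℕ.+ 1) ℕ.* (q ℕ.* q ℕ.+ q ℕ.+ 1)) →
      + (q ℕ.* q ℕ.+ q) * x - + offset ≤ + (q ℕ.* (q ℕ.+ 1) ℕ.* (2 ℕ.* q ℕ.* q ℕ.+ q ℕ.+ 1))
    deficit-sum-≤ x x≤ = begin
      P * x - + offset             ≤⟨ IntP.+-monoˡ-≤ (Int.- + offset) (IntP.*-monoˡ-≤-nonNeg P x≤) ⟩
      P * + B - + offset           ≡⟨ cong (_- + offset) (sym (IntP.pos-* P′ B)) ⟩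
      + (P′ ℕ.* B) - + offset      ≡⟨ cong (λ k → + k - + offset) bound+offset ⟩
      + (R ℕ.+ offset) - + offset  ≡⟨ cong (_- + offset) (IntP.pos-+ R offset) ⟩
      + R + + offset - + offset    ≡⟨ add-sub (+ R) (+ offset) ⟩
      + R                          ∎
      where
      open IntP.≤-Reasoning
      P′ = q ℕ.* q ℕ.+ q
      P = + P′
      B = (q ℕ.+ 1) ℕ.* (q ℕ.* q ℕ.+ q ℕ.+ 1)
      R = q ℕ.* (q ℕ.+ 1) ℕ.* (2 ℕ.* q ℕ.* q ℕ.+ q ℕ.+ 1)
      add-sub : ∀ r k → r + k - k ≡ r
      add-sub = ℤ-Solver.solve-∀

  x-lower-bound : ∀ q .{{_ : ℕ.NonZero q}} x →
                  0ℤ ≤ + (q ℕ.* q ℕ.+ q) * x - + offset q → + (q ℕ.^ 3 ℕ.+ q) ≤ x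
  x-lower-bound q@(ℕ.suc _) x 0≤Px-offset = IntP.*-cancelˡ-≤-pos (+ (q ℕ.^ 3 ℕ.+ q)) x P (begin
    P * + (q ℕ.^ 3 ℕ.+ q)                      ≡⟨ sym (IntP.pos-* (q ℕ.* q ℕ.+ q) _) ⟩
    + ((q ℕ.* q ℕ.+ q) ℕ.* (q ℕ.^ 3 ℕ.+ q))    ≡⟨ cong +_ (offset-factorisation q) ⟩
    + offset q                                 ≤⟨ IntP.0≤i-j⇒j≤i 0≤Px-offset ⟩
    P * x                                      ∎)
    where
    open IntP.≤-Reasoning
    P = + (q ℕ.* q ℕ.+ q)

open Int using (_≤_; _-_; _*_; _+_; 0ℤ)
open Arithmetic
open DecidableCounting using (count; sum)

lemma5p2 : ∀ {q : ℕ} (F : FiniteField q) → let open Geometry F 8 in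
    (L : Plane → Set) → (∀ {τ σ} → τ ≈ σ → L τ → L σ) →
    (x : ℤ) → x ≤ + ((q ℕ.+ 1) ℕ.* (q ℕ.* q ℕ.+ q ℕ.+ 1)) →
    (∀ (τ : Plane) → ¬ L τ →
       Σ[ c ∈ ℕ ] (Count (λ σ → L σ × MeetInLine τ σ) c × (+ c ≡ x))) →
    (∀ (τ : Plane) → L τ →
       Σ[ c ∈ ℕ ] (Count (λ σ → L σ × MeetInLine τ σ) c × (+ c ≡ λ₂ q + x))) →
    (π : Plane) → L π →
    (∀ (g : Line) → g ⊆ π → ¬ (∀ (τ : Plane) → g ⊆ τ → L τ)) →
    ((∀ {m : ℕ} (gs : Vec Line m) → EnumLinesOf π gs →
       (cs : Vec ℕ m) →
       (∀ i → Count (λ τ → L τ × (lookup gs i ⊆ τ)) (lookup cs i)) →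
       (sumℤ (map (λ c → x - + c) cs)
          ≡ + (q ℕ.* q ℕ.+ q) * x
            - + (q ℕ.* q ℕ.* (q ℕ.^ 3 ℕ.+ q ℕ.^ 2 ℕ.+ q ℕ.+ 1)))
       × (sumℤ (map (λ c → x - + c) cs)
          ≤ + (q ℕ.* (q ℕ.+ 1) ℕ.* (2 ℕ.* q ℕ.* q ℕ.+ q ℕ.+ 1))))
     × (+ (q ℕ.^ 3 ℕ.+ q) ≤ x))
lemma5p2 {q} F L L-resp-≈ x x≤ non-L-neighbours L-neighbours π Lπ no-full-line = deficit-sum , x-bound
  where
  open Geometry F 8 using (Line; Count; EnumLinesOf; _⊆_)
  N = proj₁ (L-neighbours π Lπ)
  open DoubleCounting F 8 L L-resp-≈ π Lπ (proj₁ (proj₂ (L-neighbours π Lπ)))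
  open LinesOfPlane F 8 π using (lines-of-plane)
  open Subspaces F 8 using (count-unique)

  deficit-sum : ∀ {m} (gs : Vec Line m) → EnumLinesOf π gs → (cs : Vec ℕ m) →
    (∀ i → Count (λ τ → L τ × (lookup gs i ⊆ τ)) (lookup cs i)) →
    (sumℤ (map (λ c → x - + c) cs) ≡ + (q ℕ.* q ℕ.+ q) * x - + offset q)
    × (sumℤ (map (λ c → x - + c) cs) ≤ + (q ℕ.* (q ℕ.+ 1) ℕ.* (2 ℕ.* q ℕ.* q ℕ.+ q ℕ.+ 1)))
  deficit-sum {m} gs gs-lines cs cs-count = S≡ , subst (_≤ _) (sym S≡) (deficit-sum-≤ q x x≤)
    where
    open ≡-Reasoning
    S≡ : sumℤ (map (λ c → x - + c) cs) ≡ + (q ℕ.* q ℕ.+ q) * x - + offset q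
    S≡ = begin
      sumℤ (map (λ c → x - + c) cs)
        ≡⟨ sumℤ-deficits x cs ⟩
      + m * x - + sum (lookup cs)
        ≡⟨ cong (λ s → + m * x - + s) (line-counts-sum gs gs-lines cs cs-count) ⟩
      + m * x - + (m ℕ.+ N)
        ≡⟨ cong (λ m → + m * x - + (m ℕ.+ N)) (count-unique (gs , gs-lines) lines-of-plane) ⟩
      + lines q * x - + (lines q ℕ.+ N)
        ≡⟨ deficit-sum-closed-form q x N (proj₂ (proj₂ (L-neighbours π Lπ))) ⟩
      + (q ℕ.* q ℕ.+ q) * x - + offset q ∎

  x-bound : + (q ℕ.^ 3 ℕ.+ q) ≤ x
  x-bound = x-lower-bound q {{FinP.nonZeroIndex (FiniteField.0# F)}} x
    (subst (0ℤ ≤_) (proj₁ (deficit-sum gs gs-lines cs (through-counts-count gs gs-lines)))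
           (sumℤ-deficits-nonneg x cs (through-counts-≤ gs gs-lines x non-L-neighbours no-full-line)))
    where
    gs = proj₁ lines-of-plane
    gs-lines = proj₂ lines-of-plane
    cs = through-counts gs gs-lines
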